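{- Let $t,t'$ be rooted trees with $|t|\le|t'|$. Then: (1) $n(t;t')\,|SG(t')|=|SG(t)|\,m(t;t')$; (2) if $|t|\le k\le|t'|$, then $n(t;t')=\sum_{|t''|=k}n(t;t'')\,n(t'';t')$, and likewise $m(t;t')=\sum_{|t''|=k}m(t;t'')\,m(t'';t')$ (sums over rooted trees $t''$ with $k$ vertices); (3) $n(t;t')$ and $m(t;t')$ are nonzero if and only if $t\preceq t'$.
   Context: A rooted tree is a finite partially ordered set (elements called vertices) with a unique greatest element, the root, such that for every vertex $v$ the set of vertices greater than $v$ is a chain; if $v$ covers $w$, $w$ is a child of $v$. We regard it as a directed graph with edges from each vertex to its children; a vertex is terminal if it has no children. Rooted trees are considered up to isomorphism; $\mathcal T$ is the set of finite rooted trees, $|t|$ the number of vertices, $\bullet$ the one-vertex tree. Write $t\preceq t'$ if $t$ can be obtained from $t'$ by removing some non-root vertices and edges (leaving a rooted tree), and $t\lhd t'$ if $t$ is obtained from $t'$ by deleting one terminal non-root vertex and the edge into it. For $t\lhd t'$, $n_1(t;t')$ is the number of vertices of $t$ at which attaching a new edge to a new terminal vertex yields $t'$, and $m_1(t;t')$ is the number of edges of $t'$ whose removal (with their terminal endpoint) leaves $t$. For a vertex $v$ of $t$, $t_v$ is the rooted tree of $v$ and its descendants; if $v$ has children $v_1,\dots,v_k$, $SG(t,v)$ is the group generated by the exchanges of $t_{v_i}$ with $t_{v_j}$ whenever isomorphic; $SG(t)=\prod_v SG(t,v)$. Let $k$ be a field of characteristic $0$ and $k\{\mathcal T\}$ the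 vector space with basis $\mathcal T$. Growth operator: linear map $\mathfrak N(t)=\sum_{t\lhd t'}n_1(t;t')t'$; pruning operator: linear map $\mathfrak P(t)=\sum_{t'\lhd t}m_1(t';t)t'$ for $t\ne\bullet$, $\mathfrak P(\bullet)=0$. For rooted trees $t,t'$ with $|t'|-|t|=j\ge0$, the multiplicities $n(t;t')$ and $m(t;t')$ are defined by $\mathfrak N^j(t)=\sum_{|t'|=|t|+j}n(t;t')\,t'$ and $\mathfrak P^j(t')=\sum_{|t|=|t'|-j}m(t;t')\,t$ (so they agree with $n_1,m_1$ when $t\lhd t'$). -}

module Defs where

open import Data.Bool using (Bool; true; false; if_then_else_)
open import Data.Nat using (ℕ; zero; suc; _+_; _*_; _∸_)
open import Data.Nat using (_!)
open import Data.Nat.ListAction using (product)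
open import Data.List using (List; []; _∷_; _++_; map; concatMap; filter; length; deduplicate; [_])
open import Data.List.Relation.Binary.Permutation.Propositional using (_↭_)
open import Data.List.Relation.Binary.Sublist.Heterogeneous using (Sublist)
open import Relation.Binary.PropositionalEquality using (_≡_; refl; cong; cong₂)
open import Relation.Nullary using (Dec; yes; no)
open import Relation.Nullary.Decidable using (map′)
open import Data.Product using (_×_; _,_)

-- Plane rooted trees; isomorphism classes of rooted trees are
-- represented via a canonical form (children recursively sorted).

data Tree : Set where
  node : List Tree → Tree

leaf : Tree
leaf = node []

node-inj : ∀ {xs ys} → node xs ≡ node ys → xs ≡ ys
node-inj refl = refl

∷-inj : ∀ {x y : Tree} {xs ys} → (x ∷ xs) ≡ (y ∷ ys) → (x ≡ y) × (xs ≡ ys)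
∷-inj refl = refl , refl

mutual
  _≟T_ : (x y : Tree) → Dec (x ≡ y)
  node xs ≟T node ys = map′ (cong node) node-inj (xs ≟L ys)

  _≟L_ : (xs ys : List Tree) → Dec (xs ≡ ys)
  [] ≟L [] = yes refl
  [] ≟L (_ ∷ _) = no λ ()
  (_ ∷ _) ≟L [] = no λ ()
  (x ∷ xs) ≟L (y ∷ ys) with x ≟T y | xs ≟L ys
  ... | yes p | yes q = yes (cong₂ _∷_ p q)
  ... | no ¬p | _ = no λ e → ¬p (Data.Product.proj₁ (∷-inj e))
  ... | yes _ | no ¬q = no λ e → ¬q (Data.Product.proj₂ (∷-inj e))

data Cmp : Set where
  LT EQ GT : Cmp

thenCmp : Cmp → Cmp → Cmp
thenCmp EQ o = o
thenCmp LT _ = LT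
thenCmp GT _ = GT

mutual
  cmpT : Tree → Tree → Cmp
  cmpT (node xs) (node ys) = cmpL xs ys

  cmpL : List Tree → List Tree → Cmp
  cmpL [] [] = EQ
  cmpL [] (_ ∷ _) = LT
  cmpL (_ ∷ _) [] = GT
  cmpL (x ∷ xs) (y ∷ ys) = thenCmp (cmpT x y) (cmpL xs ys)

isGT : Cmp → Bool
isGT GT = true
isGT _ = false

insertT : Tree → List Tree → List Tree
insertT t [] = t ∷ []
insertT t (u ∷ us) = if isGT (cmpT t u) then u ∷ insertT t us else t ∷ u ∷ us

sortT : List Tree → List Tree
sortT [] = []
sortT (t ∷ ts) = insertT t (sortT ts)

mutual
  canonT : Tree → Tree
  canonT (node ts) = node (sortT (canonL ts))

  canonL : List Tree → List Tree
  canonL [] = []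
  canonL (t ∷ ts) = canonT t ∷ canonL ts

_≅_ : Tree → Tree → Set
t ≅ u = canonT t ≡ canonT u

_≅?_ : (t u : Tree) → Dec (t ≅ u)
t ≅? u = canonT t ≟T canonT u

-- coefficient of (the isomorphism class of) t in a formal ℕ-combination
-- of trees, represented as a list of trees
coeff : Tree → List Tree → ℕ
coeff t xs = length (filter (λ x → x ≅? t) xs)

mutual
  size : Tree → ℕ
  size (node ts) = suc (sizeL ts)

  sizeL : List Tree → ℕ
  sizeL [] = 0
  sizeL (t ∷ ts) = size t + sizeL ts

-- Growth operator: one summand for each vertex of t (attach a new leaf
-- there), so the coefficient of t' is n₁(t;t').

mutual
  growT : Tree → List Tree
  growT (node ts) = node (leaf ∷ ts) ∷ map node (growL ts)

  growL : List Tree → List (List Tree)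
  growL [] = []
  growL (t ∷ ts) = map (_∷ ts) (growT t) ++ map (t ∷_) (growL ts)

-- Pruning operator: one summand for each terminal non-root vertex of t
-- (remove it), so the coefficient of t' is m₁(t';t); 𝔓(•) = 0.

leafHere : Tree → List Tree → List (List Tree)
leafHere (node []) ts = ts ∷ []
leafHere (node (_ ∷ _)) ts = []

mutual
  pruneT : Tree → List Tree
  pruneT (node ts) = map node (pruneL ts)

  pruneL : List Tree → List (List Tree)
  pruneL [] = []
  pruneL (t ∷ ts) = leafHere t ts ++ map (_∷ ts) (pruneT t) ++ map (t ∷_) (pruneL ts)

𝔑 : List Tree → List Tree
𝔑 = concatMap growT

𝔓 : List Tree → List Tree
𝔓 = concatMap pruneT

iter : {A : Set} → ℕ → (A → A) → A → A
iter zero f x = x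
iter (suc n) f x = f (iter n f x)

nMult : Tree → Tree → ℕ
nMult t t' = coeff t' (iter (size t' ∸ size t) 𝔑 (t ∷ []))

mMult : Tree → Tree → ℕ
mMult t t' = coeff t (iter (size t' ∸ size t) 𝔓 (t' ∷ []))

-- |SG(t)| = ∏_v |SG(t,v)|, where SG(t,v) (generated by exchanging
-- isomorphic child subtrees of v) is the product over the isomorphism
-- classes of children of v of the symmetric group on that class, so
-- |SG(t,v)| = ∏_{classes c} (#children of v in c)!.

symFactor : List Tree → ℕ
symFactor ts = product (map (λ c → coeff c ts !) (deduplicate _≅?_ ts))

mutual
  sgOrder : Tree → ℕ
  sgOrder (node ts) = symFactor ts * sgOrderL ts

  sgOrderL : List Tree → ℕ
  sgOrderL [] = 1
  sgOrderL (t ∷ ts) = sgOrder t * sgOrderL ts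

-- t ⪯ t' : t is obtained from t' by removing non-root vertices (closed
-- under descendants) — i.e. the children subtrees of t embed injectively,
-- up to reordering, into those of t', each recursively.

data _⪯_ : Tree → Tree → Set where
  emb : ∀ {ts us us'} → us ↭ us' → Sublist _⪯_ ts us' → node ts ⪯ node us

-- Enumeration of rooted trees with k vertices, one representative
-- (the canonical one) for each isomorphism class.

mutual
  -- all plane trees with exactly n vertices (given enough fuel)
  treesF : ℕ → ℕ → List Tree
  treesF zero _ = []
  treesF (suc f) zero = []
  treesF (suc f) (suc n) = map node (forestsF f n)

  forestsF : ℕ → ℕ → List (List Tree)
  forestsF _ zero = [] ∷ []
  forestsF zero (suc _) = []
  forestsF (suc f) (suc n) = splits f (suc n) (suc n)

  -- forests of total size m whose first tree has size in 1..i
  splits : ℕ → ℕ → ℕ → List (List Tree)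
  splits f m zero = []
  splits f m (suc i) =
    concatMap (λ t → map (t ∷_) (forestsF f (m ∸ suc i))) (treesF f (suc i))
    ++ splits f m i

isCanon : (t : Tree) → Dec (canonT t ≡ t)
isCanon t = canonT t ≟T t

treesOfSize : ℕ → List Tree
treesOfSize k = filter isCanon (treesF (suc (suc (k + k))) k)

{-# OPTIONS --safe #-}

-- The number of isomorphisms t → u of rooted trees is |SG(t)| if t ≅ u and 0 otherwise.
-- Attaching a leaf to t and then mapping isomorphically onto u corresponds bijectively to
-- choosing a leaf of u and mapping t isomorphically onto u with that leaf pruned; counting both
-- sides gives n₁(t;u)|SG(u)| = |SG(t)| m₁(t;u).  The coefficients of 𝔑 and 𝔓 depend only on
-- isomorphism classes, so 𝔑^(a+b) = 𝔑^b ∘ 𝔑^a (and likewise for 𝔓) expands over one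
-- representative of each class of intermediate size, which is (2); (1) then follows from the
-- one-step case by induction.  For (3), growing never leaves {t' | t ⪯ t'}, and whenever t ⪯ t'
-- with |t| < |t'| some one-leaf growth of t still embeds in t'; as |SG| > 0, (1) transfers the
-- criterion from n to m.

module Submission where

open import Data.Bool using (true; false)
import Data.Bool as Bool
open import Data.Empty using (⊥-elim)
open import Data.List using (List; []; _∷_; _++_; [_]; map; concatMap; concat; filter; length; deduplicate)
open import Data.List.Properties using (map-++; map-∘; map-cong; map-cong-local; concatMap-++; filter-none)
open import Data.List.Relation.Binary.Permutation.Propositional
  using (_↭_; ↭-refl; ↭-sym; ↭-trans; ↭-prep; ↭-swap; ↭-reflexive; ↭⇒↭ₛ)
import Data.List.Relation.Binary.Permutation.Propositional as ↭
open import Data.List.Relation.Binary.Permutation.Propositional.Properties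
  using (map⁺; filter-↭; ↭-length; drop-∷; All-resp-↭)
open import Data.List.Relation.Binary.Pointwise using (Pointwise-≡⇒≡)
open import Data.List.Relation.Binary.Sublist.Heterogeneous using (Sublist; []; _∷ʳ_; _∷_; minimum)
open import Data.List.Relation.Unary.All as All using (All; []; _∷_)
import Data.List.Relation.Unary.All.Properties as Allₚ
open import Data.List.Relation.Unary.Any as Any using (Any; here; there)
import Data.List.Relation.Unary.Any.Properties as Anyₚ
open import Data.List.Relation.Unary.Sorted.TotalOrder.Properties using (↗↭↗⇒≋)
open import Data.Nat using (ℕ; zero; suc; pred; _+_; _*_; _∸_; _^_; _!; _⊓_; _≤_; _<_; z≤n; s≤s; NonZero)
open import Data.Nat.ListAction using (sum; product)
open import Data.Nat.ListAction.Properties using (sum-++; sum-↭; product-↭; product≢0)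
open import Data.Nat.Properties
open import Data.Nat.Tactic.RingSolver using (solve-∀)
open import Data.Product using (_×_; _,_; proj₁; proj₂; ∃-syntax; uncurry; map₂)
open import Data.Sum using (_⊎_; inj₁; inj₂)
open import Function using (_∘_)
open import Function.Bundles using (_⇔_; mk⇔)
import Function.Properties.Equivalence as ⇔
open import Relation.Binary.Bundles using (DecTotalOrder)
open import Relation.Binary.PropositionalEquality hiding ([_])
open import Relation.Nullary using (Dec; yes; no; ¬_; ¬?)

open import Defs

-- Finite sums and indicators

∑ : {A : Set} → List A → (A → ℕ) → ℕ
∑ xs f = sum (map f xs)

∑-++ : {A : Set} (xs ys : List A) (f : A → ℕ) → ∑ (xs ++ ys) f ≡ ∑ xs f + ∑ ys f
∑-++ xs ys f = trans (cong sum (map-++ f xs ys)) (sum-++ (map f xs) (map f ys))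

∑-map : {A B : Set} (g : A → B) (xs : List A) (f : B → ℕ) → ∑ (map g xs) f ≡ ∑ xs (f ∘ g)
∑-map g xs f = cong sum (sym (map-∘ xs))

∑-++-map : {A B : Set} (xs : List B) (ys : List A) (g : A → B) (f : B → ℕ) →
  ∑ (xs ++ map g ys) f ≡ ∑ xs f + ∑ ys (f ∘ g)
∑-++-map xs ys g f = trans (∑-++ xs (map g ys) f) (cong (∑ xs f +_) (∑-map g ys f))

∑-cong : {A : Set} (xs : List A) {f g : A → ℕ} → (∀ x → f x ≡ g x) → ∑ xs f ≡ ∑ xs g
∑-cong xs e = cong sum (map-cong e xs)

∑-cong-All : {A : Set} {xs : List A} {f g : A → ℕ} → All (λ x → f x ≡ g x) xs → ∑ xs f ≡ ∑ xs g
∑-cong-All e = cong sum (map-cong-local e)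

∑-↭ : {A : Set} {xs ys : List A} (f : A → ℕ) → xs ↭ ys → ∑ xs f ≡ ∑ ys f
∑-↭ f p = sum-↭ (map⁺ f p)

∑-zero : {A : Set} (xs : List A) → ∑ xs (λ _ → 0) ≡ 0
∑-zero [] = refl
∑-zero (x ∷ xs) = ∑-zero xs

∑-+ : {A : Set} (xs : List A) (f g : A → ℕ) → ∑ xs (λ x → f x + g x) ≡ ∑ xs f + ∑ xs g
∑-+ [] f g = refl
∑-+ (x ∷ xs) f g = begin
  f x + g x + ∑ xs (λ x → f x + g x) ≡⟨ cong (f x + g x +_) (∑-+ xs f g) ⟩
  f x + g x + (∑ xs f + ∑ xs g)       ≡⟨ +-assoc (f x) (g x) _ ⟩
  f x + (g x + (∑ xs f + ∑ xs g))     ≡⟨ cong (f x +_) (x+[y+z]≡y+[x+z] (g x) (∑ xs f) (∑ xs g)) ⟩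
  f x + (∑ xs f + (g x + ∑ xs g))     ≡⟨ +-assoc (f x) (∑ xs f) _ ⟨
  f x + ∑ xs f + (g x + ∑ xs g)       ∎
  where
  open ≡-Reasoning
  x+[y+z]≡y+[x+z] : ∀ a b c → a + (b + c) ≡ b + (a + c)
  x+[y+z]≡y+[x+z] = solve-∀

∑-*ˡ : {A : Set} (a : ℕ) (xs : List A) (f : A → ℕ) → ∑ xs (λ x → a * f x) ≡ a * ∑ xs f
∑-*ˡ a [] f = sym (*-zeroʳ a)
∑-*ˡ a (x ∷ xs) f = trans (cong (a * f x +_) (∑-*ˡ a xs f)) (sym (*-distribˡ-+ a (f x) (∑ xs f)))

∑-*ʳ : {A : Set} (a : ℕ) (xs : List A) (f : A → ℕ) → ∑ xs (λ x → f x * a) ≡ ∑ xs f * a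
∑-*ʳ a xs f = begin
  ∑ xs (λ x → f x * a) ≡⟨ ∑-cong xs (λ x → *-comm (f x) a) ⟩
  ∑ xs (λ x → a * f x) ≡⟨ ∑-*ˡ a xs f ⟩
  a * ∑ xs f           ≡⟨ *-comm a (∑ xs f) ⟩
  ∑ xs f * a           ∎
  where open ≡-Reasoning

∑-swap : {A B : Set} (xs : List A) (ys : List B) (f : A → B → ℕ) →
  ∑ xs (λ x → ∑ ys (f x)) ≡ ∑ ys (λ y → ∑ xs (λ x → f x y))
∑-swap [] ys f = sym (∑-zero ys)
∑-swap (x ∷ xs) ys f = trans (cong (∑ ys (f x) +_) (∑-swap xs ys f)) (sym (∑-+ ys (f x) _))

∑-concatMap : {A B : Set} (g : A → List B) (xs : List A) (f : B → ℕ) →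
  ∑ (concatMap g xs) f ≡ ∑ xs (λ x → ∑ (g x) f)
∑-concatMap g [] f = refl
∑-concatMap g (x ∷ xs) f = trans (∑-++ (g x) (concat (map g xs)) f) (cong (∑ (g x) f +_) (∑-concatMap g xs f))

∑-≢0 : {A : Set} (xs : List A) (f : A → ℕ) → Any (λ x → f x ≢ 0) xs → ∑ xs f ≢ 0
∑-≢0 (x ∷ xs) f (here fx≢0) e = fx≢0 (m+n≡0⇒m≡0 (f x) e)
∑-≢0 (x ∷ xs) f (there any) e = ∑-≢0 xs f any (m+n≡0⇒n≡0 (f x) e)

χ : {P : Set} → Dec P → ℕ
χ (yes _) = 1
χ (no _) = 0

χ-yes : {P : Set} (d : Dec P) → P → χ d ≡ 1
χ-yes (yes _) _ = refl
χ-yes (no ¬p) p = ⊥-elim (¬p p)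

χ-no : {P : Set} (d : Dec P) → ¬ P → χ d ≡ 0
χ-no (yes p) ¬p = ⊥-elim (¬p p)
χ-no (no _) _ = refl

χ-cong : {P Q : Set} (d : Dec P) (e : Dec Q) → (P → Q) → (Q → P) → χ d ≡ χ e
χ-cong (yes _) (yes _) _ _ = refl
χ-cong (yes p) (no ¬q) f _ = ⊥-elim (¬q (f p))
χ-cong (no ¬p) (yes q) _ g = ⊥-elim (¬p (g q))
χ-cong (no _) (no _) _ _ = refl

χ-*-congʳ : {P : Set} (d : Dec P) {a b : ℕ} → (P → a ≡ b) → χ d * a ≡ χ d * b
χ-*-congʳ (yes p) e = cong (_+ 0) (e p)
χ-*-congʳ (no _) e = refl

∑-filter : {A : Set} {Q : A → Set} (Q? : (a : A) → Dec (Q a)) (xs : List A) (f : A → ℕ) →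
  ∑ (filter Q? xs) f ≡ ∑ xs (λ x → χ (Q? x) * f x)
∑-filter Q? [] f = refl
∑-filter Q? (x ∷ xs) f with Q? x
... | yes _ = cong₂ _+_ (sym (+-identityʳ (f x))) (∑-filter Q? xs f)
... | no _ = ∑-filter Q? xs f

coeff-∷ : (t x : Tree) (xs : List Tree) → coeff t (x ∷ xs) ≡ χ (x ≅? t) + coeff t xs
coeff-∷ t x xs with x ≅? t
... | yes _ = refl
... | no _ = refl

coeff-∷-self : (t : Tree) (ts : List Tree) → coeff t (t ∷ ts) ≡ suc (coeff t ts)
coeff-∷-self t ts = trans (coeff-∷ t t ts) (cong (_+ coeff t ts) (χ-yes (t ≅? t) refl))

coeff-singleton : (t x : Tree) → coeff t [ x ] ≡ χ (x ≅? t)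
coeff-singleton t x = trans (coeff-∷ t x []) (+-identityʳ (χ (x ≅? t)))

length-filter≡∑ : {A : Set} {P : A → Set} (P? : (a : A) → Dec (P a)) (xs : List A) →
  length (filter P? xs) ≡ ∑ xs (λ x → χ (P? x))
length-filter≡∑ P? [] = refl
length-filter≡∑ P? (x ∷ xs) with P? x
... | yes _ = cong suc (length-filter≡∑ P? xs)
... | no _ = length-filter≡∑ P? xs

coeff≡∑ : (t : Tree) (xs : List Tree) → coeff t xs ≡ ∑ xs (λ x → χ (x ≅? t))
coeff≡∑ t = length-filter≡∑ (_≅? t)

coeff-++ : (t : Tree) (xs ys : List Tree) → coeff t (xs ++ ys) ≡ coeff t xs + coeff t ys
coeff-++ t xs ys = begin
  coeff t (xs ++ ys)                    ≡⟨ coeff≡∑ t (xs ++ ys) ⟩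
  ∑ (xs ++ ys) (λ x → χ (x ≅? t))       ≡⟨ ∑-++ xs ys _ ⟩
  ∑ xs (λ x → χ (x ≅? t)) + ∑ ys (λ x → χ (x ≅? t)) ≡⟨ sym (cong₂ _+_ (coeff≡∑ t xs) (coeff≡∑ t ys)) ⟩
  coeff t xs + coeff t ys               ∎
  where open ≡-Reasoning

coeff-++-[] : (t : Tree) (xs : List Tree) → coeff t (xs ++ []) ≡ coeff t xs
coeff-++-[] t xs = trans (coeff-++ t xs []) (+-identityʳ (coeff t xs))

coeff-concatMap : (t : Tree) (g : Tree → List Tree) (xs : List Tree) →
  coeff t (concatMap g xs) ≡ ∑ xs (λ x → coeff t (g x))
coeff-concatMap t g xs = begin
  coeff t (concatMap g xs)                  ≡⟨ coeff≡∑ t (concatMap g xs) ⟩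
  ∑ (concatMap g xs) (λ x → χ (x ≅? t))     ≡⟨ ∑-concatMap g xs _ ⟩
  ∑ xs (λ x → ∑ (g x) (λ y → χ (y ≅? t)))   ≡⟨ ∑-cong xs (λ x → sym (coeff≡∑ t (g x))) ⟩
  ∑ xs (λ x → coeff t (g x))                ∎
  where open ≡-Reasoning

coeff-↭ : (t : Tree) {xs ys : List Tree} → xs ↭ ys → coeff t xs ≡ coeff t ys
coeff-↭ t p = ↭-length (filter-↭ (_≅? t) p)

-- The order on plane trees and insertion sort

flipCmp : Cmp → Cmp
flipCmp LT = GT
flipCmp EQ = EQ
flipCmp GT = LT

thenCmp-flip : ∀ c d → flipCmp (thenCmp c d) ≡ thenCmp (flipCmp c) (flipCmp d)
thenCmp-flip LT d = refl
thenCmp-flip EQ d = refl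
thenCmp-flip GT d = refl

thenCmp-EQ : ∀ c d → thenCmp c d ≡ EQ → c ≡ EQ × d ≡ EQ
thenCmp-EQ EQ d e = refl , e

mutual
  cmpT-flip : ∀ a b → cmpT b a ≡ flipCmp (cmpT a b)
  cmpT-flip (node xs) (node ys) = cmpL-flip xs ys

  cmpL-flip : ∀ xs ys → cmpL ys xs ≡ flipCmp (cmpL xs ys)
  cmpL-flip [] [] = refl
  cmpL-flip [] (_ ∷ _) = refl
  cmpL-flip (_ ∷ _) [] = refl
  cmpL-flip (x ∷ xs) (y ∷ ys) rewrite cmpT-flip x y | cmpL-flip xs ys =
    sym (thenCmp-flip (cmpT x y) (cmpL xs ys))

mutual
  cmpT-refl : ∀ a → cmpT a a ≡ EQ
  cmpT-refl (node xs) = cmpL-refl xs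

  cmpL-refl : ∀ xs → cmpL xs xs ≡ EQ
  cmpL-refl [] = refl
  cmpL-refl (x ∷ xs) rewrite cmpT-refl x = cmpL-refl xs

mutual
  cmpT-EQ⇒≡ : ∀ a b → cmpT a b ≡ EQ → a ≡ b
  cmpT-EQ⇒≡ (node xs) (node ys) e = cong node (cmpL-EQ⇒≡ xs ys e)

  cmpL-EQ⇒≡ : ∀ xs ys → cmpL xs ys ≡ EQ → xs ≡ ys
  cmpL-EQ⇒≡ [] [] e = refl
  cmpL-EQ⇒≡ (x ∷ xs) (y ∷ ys) e with thenCmp-EQ (cmpT x y) (cmpL xs ys) e
  ... | x≡y , xs≡ys = cong₂ _∷_ (cmpT-EQ⇒≡ x y x≡y) (cmpL-EQ⇒≡ xs ys xs≡ys)

mutual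
  cmpT-LT-trans : ∀ a b c → cmpT a b ≡ LT → cmpT b c ≡ LT → cmpT a c ≡ LT
  cmpT-LT-trans (node xs) (node ys) (node zs) = cmpL-LT-trans xs ys zs

  cmpL-LT-trans : ∀ xs ys zs → cmpL xs ys ≡ LT → cmpL ys zs ≡ LT → cmpL xs zs ≡ LT
  cmpL-LT-trans [] (y ∷ ys) (z ∷ zs) _ _ = refl
  cmpL-LT-trans (x ∷ xs) (y ∷ ys) (z ∷ zs) xs<ys ys<zs with cmpT x y in x?y | cmpT y z in y?z
  ... | LT | LT rewrite cmpT-LT-trans x y z x?y y?z = refl
  ... | LT | EQ with refl ← cmpT-EQ⇒≡ y z y?z rewrite x?y = refl
  ... | EQ | LT with refl ← cmpT-EQ⇒≡ x y x?y rewrite y?z = refl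
  ... | EQ | EQ with refl ← cmpT-EQ⇒≡ x y x?y | refl ← cmpT-EQ⇒≡ y z y?z rewrite cmpT-refl x =
    cmpL-LT-trans xs ys zs xs<ys ys<zs

_≤T_ : Tree → Tree → Set
a ≤T b = isGT (cmpT a b) ≡ false

_≤T?_ : (a b : Tree) → Dec (a ≤T b)
a ≤T? b = isGT (cmpT a b) Bool.≟ false

≤T-view : ∀ a b → a ≤T b → cmpT a b ≡ LT ⊎ a ≡ b
≤T-view a b a≤b with cmpT a b in a?b
... | LT = inj₁ refl
... | EQ = inj₂ (cmpT-EQ⇒≡ a b a?b)

LT⇒≤T : ∀ a b → cmpT a b ≡ LT → a ≤T b
LT⇒≤T a b e = cong isGT e

LT⇒≰T : ∀ a b → cmpT a b ≡ LT → ¬ b ≤T a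
LT⇒≰T a b a<b b≤a with () ← trans (sym b≤a) (cong isGT (trans (cmpT-flip a b) (cong flipCmp a<b)))

≤T-refl : ∀ a → a ≤T a
≤T-refl a = cong isGT (cmpT-refl a)

≤T-trans : ∀ {a b c} → a ≤T b → b ≤T c → a ≤T c
≤T-trans {a} {b} {c} a≤b b≤c with ≤T-view a b a≤b | ≤T-view b c b≤c
... | inj₁ a<b | inj₁ b<c = LT⇒≤T a c (cmpT-LT-trans a b c a<b b<c)
... | inj₁ a<b | inj₂ refl = a≤b
... | inj₂ refl | _ = b≤c

≤T-antisym : ∀ {a b} → a ≤T b → b ≤T a → a ≡ b
≤T-antisym {a} {b} a≤b b≤a with ≤T-view a b a≤b
... | inj₁ a<b = ⊥-elim (LT⇒≰T a b a<b b≤a)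
... | inj₂ a≡b = a≡b

≤T-total : ∀ a b → a ≤T b ⊎ b ≤T a
≤T-total a b with cmpT a b in a?b
... | LT = inj₁ refl
... | EQ = inj₁ refl
... | GT = inj₂ (LT⇒≤T b a (trans (cmpT-flip a b) (cong flipCmp a?b)))

treeOrder : DecTotalOrder _ _ _
treeOrder = record
  { Carrier = Tree
  ; _≈_ = _≡_
  ; _≤_ = _≤T_
  ; isDecTotalOrder = record
    { isTotalOrder = record
      { isPartialOrder = record
        { isPreorder = record
          { isEquivalence = isEquivalence
          ; reflexive = λ { {a} refl → ≤T-refl a }
          ; trans = λ {a} {b} {c} → ≤T-trans {a} {b} {c}
          }
        ; antisym = ≤T-antisym
        }
      ; total = ≤T-total
      }
    ; _≟_ = _≟T_
    ; _≤?_ = _≤T?_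
    }
  }

open import Data.List.Sort.InsertionSort.Base treeOrder using (insert; sort)
open import Data.List.Sort.InsertionSort.Properties treeOrder using (sort-↭; sort-↗)
open import Data.List.Relation.Unary.Sorted.TotalOrder (DecTotalOrder.totalOrder treeOrder) using (Sorted)

insertT≡insert : ∀ a us → insertT a us ≡ insert a us
insertT≡insert a [] = refl
insertT≡insert a (u ∷ us) with isGT (cmpT a u)
... | true = cong (u ∷_) (insertT≡insert a us)
... | false = refl

sortT≡sort : ∀ ts → sortT ts ≡ sort ts
sortT≡sort [] = refl
sortT≡sort (t ∷ ts) = trans (insertT≡insert t (sortT ts)) (cong (insert t) (sortT≡sort ts))

sortT-↭ : ∀ ts → sortT ts ↭ ts
sortT-↭ ts = subst (_↭ ts) (sym (sortT≡sort ts)) (sort-↭ ts)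

sortT-sorted : ∀ ts → Sorted (sortT ts)
sortT-sorted ts = subst Sorted (sym (sortT≡sort ts)) (sort-↗ ts)

sorted-↭-unique : ∀ {xs ys} → Sorted xs → Sorted ys → xs ↭ ys → xs ≡ ys
sorted-↭-unique xs↗ ys↗ p =
  Pointwise-≡⇒≡ (↗↭↗⇒≋ (DecTotalOrder.totalOrder treeOrder) xs↗ ys↗ (↭⇒↭ₛ p))

sortT-cong-↭ : ∀ {xs ys} → xs ↭ ys → sortT xs ≡ sortT ys
sortT-cong-↭ {xs} {ys} p =
  sorted-↭-unique (sortT-sorted xs) (sortT-sorted ys) (↭-trans (sortT-↭ xs) (↭-trans p (↭-sym (sortT-↭ ys))))

sortT-sorted-id : ∀ {xs} → Sorted xs → sortT xs ≡ xs
sortT-sorted-id {xs} xs↗ = sorted-↭-unique (sortT-sorted xs) xs↗ (sortT-↭ xs)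

-- Canonical forms and isomorphism

canonL≡map : ∀ ts → canonL ts ≡ map canonT ts
canonL≡map [] = refl
canonL≡map (t ∷ ts) = cong (canonT t ∷_) (canonL≡map ts)

canonL-↭ : ∀ {F G} → F ↭ G → canonL F ↭ canonL G
canonL-↭ {F} {G} p rewrite canonL≡map F | canonL≡map G = map⁺ canonT p

canonL-fixed : ∀ {ts} → All (λ t → canonT t ≡ t) ts → canonL ts ≡ ts
canonL-fixed [] = refl
canonL-fixed (e ∷ es) = cong₂ _∷_ e (canonL-fixed es)

mutual
  canonT-≅ : ∀ t → canonT t ≅ t
  canonT-≅ (node ts) = cong node (begin
    sortT (canonL (sortT (canonL ts)))
      ≡⟨ cong sortT (canonL-fixed (All-resp-↭ (↭-sym (sortT-↭ (canonL ts))) (canonL-canonical ts))) ⟩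
    sortT (sortT (canonL ts))
      ≡⟨ sortT-sorted-id (sortT-sorted (canonL ts)) ⟩
    sortT (canonL ts) ∎)
    where open ≡-Reasoning

  canonL-canonical : ∀ ts → All (λ t → canonT t ≡ t) (canonL ts)
  canonL-canonical [] = []
  canonL-canonical (t ∷ ts) = canonT-≅ t ∷ canonL-canonical ts

node-≅⇒↭ : ∀ {F G} → node F ≅ node G → canonL F ↭ canonL G
node-≅⇒↭ {F} {G} e =
  ↭-trans (↭-sym (sortT-↭ (canonL F))) (subst (_↭ canonL G) (sym (node-inj e)) (sortT-↭ (canonL G)))

↭⇒node-≅ : ∀ {F G} → canonL F ↭ canonL G → node F ≅ node G
↭⇒node-≅ p = cong node (sortT-cong-↭ p)

node-≅-↭ : ∀ {F G} → F ↭ G → node F ≅ node G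
node-≅-↭ p = ↭⇒node-≅ (canonL-↭ p)

node-≅-∷ : ∀ a b F G → a ≅ b → node F ≅ node G → node (a ∷ F) ≅ node (b ∷ G)
node-≅-∷ a b F G a≅b e =
  ↭⇒node-≅ (↭-trans (↭-prep (canonT a) (node-≅⇒↭ {F} {G} e)) (↭-reflexive (cong (_∷ canonL G) a≅b)))

node-≅-∷⁻ : ∀ a b F G → a ≅ b → node (a ∷ F) ≅ node (b ∷ G) → node F ≅ node G
node-≅-∷⁻ a b F G a≅b e =
  ↭⇒node-≅ (drop-∷ (↭-trans (node-≅⇒↭ {a ∷ F} {b ∷ G} e) (↭-reflexive (cong (_∷ canonL G) (sym a≅b)))))

leaf-≇-node∷ : ∀ g gs → ¬ leaf ≅ node (g ∷ gs)
leaf-≇-node∷ g gs e with () ← ↭-length (node-≅⇒↭ {[]} {g ∷ gs} e)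

coeff-resp-≅ : ∀ {x y} L → x ≅ y → coeff x L ≡ coeff y L
coeff-resp-≅ {x} {y} L x≅y = begin
  coeff x L
    ≡⟨ coeff≡∑ x L ⟩
  ∑ L (λ z → χ (z ≅? x))
    ≡⟨ ∑-cong L (λ z → χ-cong (z ≅? x) (z ≅? y) (λ e → trans e x≅y) (λ e → trans e (sym x≅y))) ⟩
  ∑ L (λ z → χ (z ≅? y))
    ≡⟨ coeff≡∑ y L ⟨
  coeff y L ∎
  where open ≡-Reasoning

coeff-canonL : ∀ x F → coeff x (canonL F) ≡ coeff x F
coeff-canonL x [] = refl
coeff-canonL x (y ∷ F) = begin
  coeff x (canonT y ∷ canonL F)
    ≡⟨ coeff-∷ x (canonT y) (canonL F) ⟩
  χ (canonT y ≅? x) + coeff x (canonL F)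
    ≡⟨ cong₂ _+_ (χ-cong (canonT y ≅? x) (y ≅? x) (trans (sym (canonT-≅ y))) (trans (canonT-≅ y))) (coeff-canonL x F) ⟩
  χ (y ≅? x) + coeff x F
    ≡⟨ coeff-∷ x y F ⟨
  coeff x (y ∷ F) ∎
  where open ≡-Reasoning

coeff-node-≅ : ∀ x F G → node F ≅ node G → coeff x F ≡ coeff x G
coeff-node-≅ x F G e = begin
  coeff x F          ≡⟨ coeff-canonL x F ⟨
  coeff x (canonL F) ≡⟨ coeff-↭ x (node-≅⇒↭ {F} {G} e) ⟩
  coeff x (canonL G) ≡⟨ coeff-canonL x G ⟩
  coeff x G          ∎
  where open ≡-Reasoning

-- Symmetry factors

filter-filter-⊆ : {A : Set} {P Q : A → Set} (P? : (a : A) → Dec (P a)) (Q? : (a : A) → Dec (Q a)) →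
  (∀ {a} → P a → Q a) → ∀ xs → filter P? (filter Q? xs) ≡ filter P? xs
filter-filter-⊆ P? Q? P⇒Q [] = refl
filter-filter-⊆ P? Q? P⇒Q (x ∷ xs) with Q? x
... | yes _ with P? x
...   | yes _ = cong (x ∷_) (filter-filter-⊆ P? Q? P⇒Q xs)
...   | no _ = filter-filter-⊆ P? Q? P⇒Q xs
filter-filter-⊆ P? Q? P⇒Q (x ∷ xs) | no ¬qx with P? x
...   | yes px = ⊥-elim (¬qx (P⇒Q px))
...   | no _ = filter-filter-⊆ P? Q? P⇒Q xs

product-filter-split : {A : Set} {P : A → Set} (P? : (a : A) → Dec (P a)) (f : A → ℕ) (xs : List A) →
  product (map f xs) ≡ product (map f (filter (¬? ∘ P?) xs)) * product (map f (filter P? xs))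
product-filter-split P? f [] = refl
product-filter-split P? f (x ∷ xs) with P? x
... | yes _ = trans (cong (f x *_) (product-filter-split P? f xs)) (x*[y*z]≡y*[x*z] (f x) rejected accepted)
  where
  rejected = product (map f (filter (¬? ∘ P?) xs))
  accepted = product (map f (filter P? xs))
  x*[y*z]≡y*[x*z] : ∀ a b c → a * (b * c) ≡ b * (a * c)
  x*[y*z]≡y*[x*z] = solve-∀
... | no _ = trans (cong (f x *_) (product-filter-split P? f xs))
                   (sym (*-assoc (f x) (product (map f (filter (¬? ∘ P?) xs))) (product (map f (filter P? xs)))))

product-const : {A : Set} {f : A → ℕ} {k : ℕ} {xs : List A} → All (λ x → f x ≡ k) xs →
  product (map f xs) ≡ k ^ length xs
product-const [] = refl
product-const (e ∷ es) = cong₂ _*_ e (product-const es)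

-- 1 ⊓ n is 0 or 1 according as n is zero or not.
deduplicate-class-count : ∀ x xs → length (filter (x ≅?_) (deduplicate _≅?_ xs)) ≡ 1 ⊓ coeff x xs
deduplicate-class-count x [] = refl
deduplicate-class-count x (y ∷ ys) rewrite coeff-∷ x y ys with x ≅? y
... | yes x≅y rewrite χ-yes (y ≅? x) (sym x≅y) =
  cong suc (cong length (filter-none (x ≅?_) (All.map (λ y≇c x≅c → y≇c (trans (sym x≅y) x≅c))
                                                          (Allₚ.all-filter (¬? ∘ (y ≅?_)) (deduplicate _≅?_ ys)))))
... | no x≇y rewrite χ-no (y ≅? x) (λ y≅x → x≇y (sym y≅x)) =
  trans (cong length (filter-filter-⊆ (x ≅?_) (¬? ∘ (y ≅?_)) (λ x≅c y≅c → x≇y (trans x≅c (sym y≅c)))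
                                      (deduplicate _≅?_ ys)))
        (deduplicate-class-count x ys)

symFactor-∷ : ∀ x xs → symFactor (x ∷ xs) ≡ suc (coeff x xs) * symFactor xs
symFactor-∷ x xs = begin
  coeff x (x ∷ xs) ! * product (map (λ c → coeff c (x ∷ xs) !) (filter (¬? ∘ (x ≅?_)) D))
    ≡⟨ cong₂ (λ a b → a ! * b) (coeff-∷-self x xs) (cong product (map-cong-local other-classes)) ⟩
  suc k ! * product (map f (filter (¬? ∘ (x ≅?_)) D))
    ≡⟨ reassoc (suc k) (k !) (product (map f (filter (¬? ∘ (x ≅?_)) D))) ⟩
  suc k * (product (map f (filter (¬? ∘ (x ≅?_)) D)) * k !)
    ≡⟨ cong (λ z → suc k * (product (map f (filter (¬? ∘ (x ≅?_)) D)) * z)) (sym class-of-x) ⟩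
  suc k * (product (map f (filter (¬? ∘ (x ≅?_)) D)) * product (map f (filter (x ≅?_) D)))
    ≡⟨ cong (suc k *_) (product-filter-split (x ≅?_) f D) ⟨
  suc k * symFactor xs ∎
  where
  open ≡-Reasoning
  D = deduplicate _≅?_ xs
  k = coeff x xs
  f : Tree → ℕ
  f c = coeff c xs !
  other-classes : All (λ c → coeff c (x ∷ xs) ! ≡ f c) (filter (¬? ∘ (x ≅?_)) D)
  other-classes = All.map (λ {c} x≇c → cong _! (trans (coeff-∷ c x xs) (cong (_+ coeff c xs) (χ-no (x ≅? c) x≇c))))
                             (Allₚ.all-filter (¬? ∘ (x ≅?_)) D)
  power-sign : ∀ n → (n !) ^ (1 ⊓ n) ≡ n !
  power-sign zero = refl
  power-sign (suc n) = *-identityʳ _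
  class-of-x : product (map f (filter (x ≅?_) D)) ≡ k !
  class-of-x = begin
    product (map f (filter (x ≅?_) D))
      ≡⟨ product-const (All.map (λ x≅c → cong _! (coeff-resp-≅ xs (sym x≅c))) (Allₚ.all-filter (x ≅?_) D)) ⟩
    (k !) ^ length (filter (x ≅?_) D)  ≡⟨ cong ((k !) ^_) (deduplicate-class-count x xs) ⟩
    (k !) ^ (1 ⊓ k)                    ≡⟨ power-sign k ⟩
    k !                                ∎
  reassoc : ∀ a b c → (a * b) * c ≡ a * (c * b)
  reassoc = solve-∀

symFactor-∷-cong : ∀ x {L L'} → symFactor L ≡ symFactor L' → coeff x L ≡ coeff x L' →
  symFactor (x ∷ L) ≡ symFactor (x ∷ L')
symFactor-∷-cong x {L} {L'} e c rewrite symFactor-∷ x L | symFactor-∷ x L' | e | c = refl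

symFactor-swap : ∀ x y L → symFactor (x ∷ y ∷ L) ≡ symFactor (y ∷ x ∷ L)
symFactor-swap x y L rewrite symFactor-∷ x (y ∷ L) | symFactor-∷ y L | symFactor-∷ y (x ∷ L) | symFactor-∷ x L
                          | coeff-∷ x y L | coeff-∷ y x L with y ≅? x
... | yes y≅x rewrite χ-yes (x ≅? y) (sym y≅x) | coeff-resp-≅ L (sym y≅x) = refl
... | no y≇x rewrite χ-no (x ≅? y) (y≇x ∘ sym) = x*[y*z]≡y*[x*z] (suc (coeff x L)) (suc (coeff y L)) (symFactor L)
  where
  x*[y*z]≡y*[x*z] : ∀ a b c → a * (b * c) ≡ b * (a * c)
  x*[y*z]≡y*[x*z] = solve-∀

symFactor-↭ : ∀ {L L'} → L ↭ L' → symFactor L ≡ symFactor L'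
symFactor-↭ ↭.refl = refl
symFactor-↭ (↭.prep x p) = symFactor-∷-cong x (symFactor-↭ p) (coeff-↭ x p)
symFactor-↭ (↭.swap x y p) =
  trans (symFactor-swap x y _) (symFactor-∷-cong y (symFactor-∷-cong x (symFactor-↭ p) (coeff-↭ x p)) (coeff-↭ y (↭-prep x p)))
symFactor-↭ (↭.trans p q) = trans (symFactor-↭ p) (symFactor-↭ q)

symFactor-canonL : ∀ F → symFactor (canonL F) ≡ symFactor F
symFactor-canonL [] = refl
symFactor-canonL (x ∷ F) rewrite symFactor-∷ (canonT x) (canonL F) | symFactor-∷ x F | symFactor-canonL F
  | coeff-resp-≅ (canonL F) (canonT-≅ x) | coeff-canonL x F = refl

sgOrderL≡product : ∀ ts → sgOrderL ts ≡ product (map sgOrder ts)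
sgOrderL≡product [] = refl
sgOrderL≡product (t ∷ ts) = cong (sgOrder t *_) (sgOrderL≡product ts)

sgOrderL-↭ : ∀ {L L'} → L ↭ L' → sgOrderL L ≡ sgOrderL L'
sgOrderL-↭ {L} {L'} p rewrite sgOrderL≡product L | sgOrderL≡product L' = product-↭ (map⁺ sgOrder p)

mutual
  sgOrder-canonT : ∀ t → sgOrder (canonT t) ≡ sgOrder t
  sgOrder-canonT (node F) =
    cong₂ _*_ (trans (symFactor-↭ (sortT-↭ (canonL F))) (symFactor-canonL F))
              (trans (sgOrderL-↭ (sortT-↭ (canonL F))) (sgOrderL-canonL F))

  sgOrderL-canonL : ∀ F → sgOrderL (canonL F) ≡ sgOrderL F
  sgOrderL-canonL [] = refl
  sgOrderL-canonL (x ∷ F) = cong₂ _*_ (sgOrder-canonT x) (sgOrderL-canonL F)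

sgOrder-resp-≅ : ∀ {t u} → t ≅ u → sgOrder t ≡ sgOrder u
sgOrder-resp-≅ {t} {u} e = trans (sym (sgOrder-canonT t)) (trans (cong sgOrder e) (sgOrder-canonT u))

symFactor-nonZero : ∀ L → NonZero (symFactor L)
symFactor-nonZero L = product≢0 (Allₚ.map⁺ (All.universal (λ c → coeff c L !≢0) (deduplicate _≅?_ L)))

mutual
  sgOrder-nonZero : ∀ t → NonZero (sgOrder t)
  sgOrder-nonZero (node F) = m*n≢0 _ _ {{symFactor-nonZero F}} {{sgOrderL-nonZero F}}

  sgOrderL-nonZero : ∀ F → NonZero (sgOrderL F)
  sgOrderL-nonZero [] = _
  sgOrderL-nonZero (x ∷ F) = m*n≢0 _ _ {{sgOrder-nonZero x}} {{sgOrderL-nonZero F}}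

-- Counting isomorphisms

picks : {A : Set} → List A → List (A × List A)
picks [] = []
picks (x ∷ xs) = (x , xs) ∷ map (map₂ (x ∷_)) (picks xs)

picks-↭ : {A : Set} (xs : List A) → All (λ p → xs ↭ proj₁ p ∷ proj₂ p) (picks xs)
picks-↭ [] = []
picks-↭ (x ∷ xs) = ↭-refl ∷ Allₚ.map⁺ (All.map (λ p → ↭-trans (↭-prep x p) (↭-swap x _ ↭-refl)) (picks-↭ xs))

∑-picks-proj₁ : {A : Set} (xs : List A) (f : A → ℕ) → ∑ (picks xs) (f ∘ proj₁) ≡ ∑ xs f
∑-picks-proj₁ [] f = refl
∑-picks-proj₁ (x ∷ xs) f = cong (f x +_) (trans (∑-map (map₂ (x ∷_)) (picks xs) (f ∘ proj₁)) (∑-picks-proj₁ xs f))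

-- isoCount t u is the number of isomorphisms t → u of rooted trees, matchCount F G that of forests:
-- the first tree of F is sent to some tree of G, the rest of F to the rest of G.
mutual
  isoCount : Tree → Tree → ℕ
  isoCount (node F) (node G) = matchCount F G

  matchCount : List Tree → List Tree → ℕ
  matchCount [] [] = 1
  matchCount [] (_ ∷ _) = 0
  matchCount (x ∷ F) G = ∑ (picks G) (uncurry λ g G' → isoCount x g * matchCount F G')

sgOrder-node-∷ : ∀ x F → sgOrder (node (x ∷ F)) ≡ sgOrder x * sgOrder (node F) * suc (coeff x F)
sgOrder-node-∷ x F = begin
  symFactor (x ∷ F) * (sgOrder x * sgOrderL F)               ≡⟨ cong (_* (sgOrder x * sgOrderL F)) (symFactor-∷ x F) ⟩
  suc (coeff x F) * symFactor F * (sgOrder x * sgOrderL F)   ≡⟨ regroup (suc (coeff x F)) (symFactor F) (sgOrder x) (sgOrderL F) ⟩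
  sgOrder x * (symFactor F * sgOrderL F) * suc (coeff x F)   ∎
  where
  open ≡-Reasoning
  regroup : ∀ c s a l → c * s * (a * l) ≡ a * (s * l) * c
  regroup = solve-∀

-- Once x ≅ g is matched, the remaining forests are isomorphic exactly when the whole forests are.
matchCount-pick : ∀ x F G g G' a b → G ↭ g ∷ G' →
  χ (x ≅? g) * a * (χ (node F ≅? node G') * b) ≡ χ (node (x ∷ F) ≅? node G) * (a * b) * χ (x ≅? g)
matchCount-pick x F G g G' a b G↭g∷G' with x ≅? g
... | no _ = sym (*-zeroʳ (χ (node (x ∷ F) ≅? node G) * (a * b)))
... | yes x≅g = begin
  1 * a * (χ (node F ≅? node G') * b)
    ≡⟨ cong (λ c → 1 * a * (c * b)) (χ-cong (node F ≅? node G') (node (x ∷ F) ≅? node G) F≅G'⇒ ⇒F≅G') ⟩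
  1 * a * (χ (node (x ∷ F) ≅? node G) * b)
    ≡⟨ regroup a b (χ (node (x ∷ F) ≅? node G)) ⟩
  χ (node (x ∷ F) ≅? node G) * (a * b) * 1 ∎
  where
  open ≡-Reasoning
  F≅G'⇒ : node F ≅ node G' → node (x ∷ F) ≅ node G
  F≅G'⇒ F≅G' = trans (node-≅-∷ x g F G' x≅g F≅G') (sym (node-≅-↭ G↭g∷G'))
  ⇒F≅G' : node (x ∷ F) ≅ node G → node F ≅ node G'
  ⇒F≅G' x∷F≅G = node-≅-∷⁻ x g F G' x≅g (trans x∷F≅G (node-≅-↭ G↭g∷G'))
  regroup : ∀ a b c → 1 * a * (c * b) ≡ c * (a * b) * 1
  regroup = solve-∀

mutual
  isoCount≡χ*sgOrder : ∀ t u → isoCount t u ≡ χ (t ≅? u) * sgOrder t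
  isoCount≡χ*sgOrder (node F) (node G) = matchCount≡χ*sgOrder F G

  matchCount≡χ*sgOrder : ∀ F G → matchCount F G ≡ χ (node F ≅? node G) * sgOrder (node F)
  matchCount≡χ*sgOrder [] [] = refl
  matchCount≡χ*sgOrder [] (g ∷ gs) = sym (cong (_* 1) (χ-no (node [] ≅? node (g ∷ gs)) (leaf-≇-node∷ g gs)))
  matchCount≡χ*sgOrder (x ∷ F) G = begin
    ∑ (picks G) (uncurry λ g G' → isoCount x g * matchCount F G')
      ≡⟨ ∑-cong (picks G) (uncurry λ g G' → cong₂ _*_ (isoCount≡χ*sgOrder x g) (matchCount≡χ*sgOrder F G')) ⟩
    ∑ (picks G) (uncurry λ g G' → χ (x ≅? g) * sgOrder x * (χ (node F ≅? node G') * sgOrder (node F)))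
      ≡⟨ ∑-cong-All (All.map (λ {p} → matchCount-pick x F G (proj₁ p) (proj₂ p) (sgOrder x) (sgOrder (node F)))
                             (picks-↭ G)) ⟩
    ∑ (picks G) (λ p → C * K * χ (x ≅? proj₁ p))
      ≡⟨ ∑-*ˡ (C * K) (picks G) _ ⟩
    C * K * ∑ (picks G) (λ p → χ (x ≅? proj₁ p))
      ≡⟨ cong (C * K *_) (∑-picks-proj₁ G (λ g → χ (x ≅? g))) ⟩
    C * K * ∑ G (λ g → χ (x ≅? g))
      ≡⟨ cong (C * K *_) (trans (∑-cong G (λ g → χ-cong (x ≅? g) (g ≅? x) sym sym)) (sym (coeff≡∑ x G))) ⟩
    C * K * coeff x G
      ≡⟨ *-assoc C K (coeff x G) ⟩
    C * (K * coeff x G)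
      ≡⟨ χ-*-congʳ (node (x ∷ F) ≅? node G) (λ x∷F≅G → trans (cong (K *_) (sym (coeff-node-≅ x (x ∷ F) G x∷F≅G)))
                                                          (trans (cong (K *_) (coeff-∷-self x F))
                                                                 (sym (sgOrder-node-∷ x F)))) ⟩
    C * sgOrder (node (x ∷ F)) ∎
    where
    open ≡-Reasoning
    C = χ (node (x ∷ F) ≅? node G)
    K = sgOrder x * sgOrder (node F)

replaceOne : {A : Set} → (A → List A) → List A → List (List A)
replaceOne f [] = []
replaceOne f (x ∷ xs) = map (_∷ xs) (f x) ++ map (x ∷_) (replaceOne f xs)

removeLeaf : List Tree → List (List Tree)
removeLeaf [] = []
removeLeaf (g ∷ gs) = leafHere g gs ++ map (g ∷_) (removeLeaf gs)

growL≡replaceOne : ∀ F → growL F ≡ replaceOne growT F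
growL≡replaceOne [] = refl
growL≡replaceOne (x ∷ F) = cong (λ R → map (_∷ F) (growT x) ++ map (x ∷_) R) (growL≡replaceOne F)

∑-pruneL : ∀ G (ψ : List Tree → ℕ) → ∑ (pruneL G) ψ ≡ ∑ (removeLeaf G) ψ + ∑ (replaceOne pruneT G) ψ
∑-pruneL [] ψ = refl
∑-pruneL (g ∷ gs) ψ = begin
  ∑ (leafHere g gs ++ map (_∷ gs) (pruneT g) ++ map (g ∷_) (pruneL gs)) ψ
    ≡⟨ trans (∑-++ (leafHere g gs) _ ψ) (cong (a +_) (∑-++-map (map (_∷ gs) (pruneT g)) (pruneL gs) (g ∷_) ψ)) ⟩
  a + (b + ∑ (pruneL gs) (ψ ∘ (g ∷_)))
    ≡⟨ cong (λ c → a + (b + c)) (∑-pruneL gs (ψ ∘ (g ∷_))) ⟩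
  a + (b + (c₁ + c₂))
    ≡⟨ rearrange a b c₁ c₂ ⟩
  (a + c₁) + (b + c₂)
    ≡⟨ cong₂ _+_ (∑-++-map (leafHere g gs) (removeLeaf gs) (g ∷_) ψ)
                 (∑-++-map (map (_∷ gs) (pruneT g)) (replaceOne pruneT gs) (g ∷_) ψ) ⟨
  ∑ (removeLeaf (g ∷ gs)) ψ + ∑ (replaceOne pruneT (g ∷ gs)) ψ ∎
  where
  open ≡-Reasoning
  a = ∑ (leafHere g gs) ψ
  b = ∑ (map (_∷ gs) (pruneT g)) ψ
  c₁ = ∑ (removeLeaf gs) (ψ ∘ (g ∷_))
  c₂ = ∑ (replaceOne pruneT gs) (ψ ∘ (g ∷_))
  rearrange : ∀ a b c d → a + (b + (c + d)) ≡ (a + c) + (b + d)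
  rearrange = solve-∀

∑-replaceOne-∷ : {A : Set} (f : A → List A) (g : A) (gs : List A) (ψ : List A → ℕ) →
  ∑ (replaceOne f (g ∷ gs)) ψ ≡ ∑ (f g) (λ z → ψ (z ∷ gs)) + ∑ (replaceOne f gs) (λ H → ψ (g ∷ H))
∑-replaceOne-∷ f g gs ψ =
  trans (∑-++-map (map (_∷ gs) (f g)) (replaceOne f gs) (g ∷_) ψ)
        (cong (_+ ∑ (replaceOne f gs) (ψ ∘ (g ∷_))) (∑-map (_∷ gs) (f g) ψ))

∑-picks-∷ : {A : Set} (g : A) (gs : List A) (φ : A → List A → ℕ) →
  ∑ (picks (g ∷ gs)) (uncurry φ) ≡ φ g gs + ∑ (picks gs) (uncurry λ a s → φ a (g ∷ s))
∑-picks-∷ g gs φ = cong (φ g gs +_) (∑-map (map₂ (g ∷_)) (picks gs) (uncurry φ))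

-- Choosing a replacement and then a pick either picks the replaced element or another one.
∑-replaceOne-picks : {A : Set} (f : A → List A) (G : List A) (φ : A → List A → ℕ) →
  ∑ (replaceOne f G) (λ H → ∑ (picks H) (uncurry φ))
  ≡ ∑ (picks G) (uncurry λ g G' → ∑ (f g) (λ z → φ z G') + ∑ (replaceOne f G') (φ g))
∑-replaceOne-picks f [] φ = refl
∑-replaceOne-picks f (g ∷ gs) φ = begin
  ∑ (replaceOne f (g ∷ gs)) (λ H → ∑ (picks H) (uncurry φ))
    ≡⟨ ∑-replaceOne-∷ f g gs _ ⟩
  ∑ (f g) (λ z → ∑ (picks (z ∷ gs)) (uncurry φ)) + ∑ (replaceOne f gs) (λ H → ∑ (picks (g ∷ H)) (uncurry φ))
    ≡⟨ cong₂ _+_ (trans (∑-cong (f g) (λ z → ∑-picks-∷ z gs φ)) (∑-+ (f g) _ _))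
                 (trans (∑-cong (replaceOne f gs) (λ H → ∑-picks-∷ g H φ)) (∑-+ (replaceOne f gs) _ _)) ⟩
  (a + ∑ (f g) (λ z → ∑ (picks gs) (uncurry λ a s → φ a (z ∷ s))))
    + (b + ∑ (replaceOne f gs) (λ H → ∑ (picks H) (uncurry λ a s → φ a (g ∷ s))))
    ≡⟨ cong₂ (λ u v → (a + u) + (b + v)) (∑-swap (f g) (picks gs) _)
                                          (trans (∑-replaceOne-picks f gs (λ a s → φ a (g ∷ s))) (∑-+ (picks gs) _ _)) ⟩
  (a + d) + (b + (c + e))
    ≡⟨ rearrange a b c d e ⟩
  (a + b) + (c + (d + e))
    ≡⟨ cong (a + b +_) (trans (cong (c +_) (sym (∑-+ (picks gs) _ _))) (sym (∑-+ (picks gs) _ _))) ⟩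
  (a + b) + ∑ (picks gs) (uncurry λ a s → ∑ (f a) (λ z → φ z (g ∷ s))
                                         + (∑ (f g) (λ z → φ a (z ∷ s)) + ∑ (replaceOne f s) (λ H → φ a (g ∷ H))))
    ≡⟨ cong (a + b +_) (∑-cong (picks gs) (uncurry λ a s →
         cong (∑ (f a) (λ z → φ z (g ∷ s)) +_) (sym (∑-replaceOne-∷ f g s (φ a))))) ⟩
  (a + b) + ∑ (picks gs) (uncurry λ a s → ∑ (f a) (λ z → φ z (g ∷ s)) + ∑ (replaceOne f (g ∷ s)) (φ a))
    ≡⟨ ∑-picks-∷ g gs (λ a s → ∑ (f a) (λ z → φ z s) + ∑ (replaceOne f s) (φ a)) ⟨
  ∑ (picks (g ∷ gs)) (uncurry λ g G' → ∑ (f g) (λ z → φ z G') + ∑ (replaceOne f G') (φ g)) ∎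
  where
  open ≡-Reasoning
  a = ∑ (f g) (λ z → φ z gs)
  b = ∑ (replaceOne f gs) (φ g)
  c = ∑ (picks gs) (uncurry λ a s → ∑ (f a) (λ z → φ z (g ∷ s)))
  d = ∑ (picks gs) (uncurry λ a s → ∑ (f g) (λ z → φ a (z ∷ s)))
  e = ∑ (picks gs) (uncurry λ a s → ∑ (replaceOne f s) (λ H → φ a (g ∷ H)))
  rearrange : ∀ a b c d e → (a + d) + (b + (c + e)) ≡ (a + b) + (c + (d + e))
  rearrange = solve-∀

∑-picks-leaf≡∑-removeLeaf : ∀ G (ψ : List Tree → ℕ) →
  ∑ (picks G) (uncurry λ g G' → isoCount leaf g * ψ G') ≡ ∑ (removeLeaf G) ψ
∑-picks-leaf≡∑-removeLeaf [] ψ = refl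
∑-picks-leaf≡∑-removeLeaf (g ∷ gs) ψ = begin
  ∑ (picks (g ∷ gs)) (uncurry λ g' G' → isoCount leaf g' * ψ G')
    ≡⟨ ∑-picks-∷ g gs (λ g' G' → isoCount leaf g' * ψ G') ⟩
  isoCount leaf g * ψ gs + ∑ (picks gs) (uncurry λ g' G' → isoCount leaf g' * ψ (g ∷ G'))
    ≡⟨ cong₂ _+_ (leaf-term g) (∑-picks-leaf≡∑-removeLeaf gs (ψ ∘ (g ∷_))) ⟩
  ∑ (leafHere g gs) ψ + ∑ (removeLeaf gs) (ψ ∘ (g ∷_))
    ≡⟨ ∑-++-map (leafHere g gs) (removeLeaf gs) (g ∷_) ψ ⟨
  ∑ (removeLeaf (g ∷ gs)) ψ ∎
  where
  open ≡-Reasoning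
  leaf-term : ∀ g → isoCount leaf g * ψ gs ≡ ∑ (leafHere g gs) ψ
  leaf-term (node []) = refl
  leaf-term (node (_ ∷ _)) = refl

∑-replaceOne-matchCount-[] : ∀ G → ∑ (replaceOne pruneT G) (matchCount []) ≡ 0
∑-replaceOne-matchCount-[] [] = refl
∑-replaceOne-matchCount-[] (g ∷ gs) =
  trans (∑-replaceOne-∷ pruneT g gs (matchCount [])) (cong₂ _+_ (∑-zero (pruneT g)) (∑-zero (replaceOne pruneT gs)))

-- Both sides count pairs (a way of growing t by a leaf, an isomorphism onto u),
-- resp. (a leaf of u, an isomorphism from t onto u with that leaf pruned).
mutual
  isoCount-grow-prune : ∀ t u → ∑ (growT t) (λ y → isoCount y u) ≡ ∑ (pruneT u) (isoCount t)
  isoCount-grow-prune (node F) (node G) = begin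
    matchCount (leaf ∷ F) G + ∑ (map node (growL F)) (λ y → isoCount y (node G))
      ≡⟨ cong₂ _+_ (∑-picks-leaf≡∑-removeLeaf G (matchCount F))
                   (trans (∑-map node (growL F) _) (cong (λ L → ∑ L (λ H → matchCount H G)) (growL≡replaceOne F))) ⟩
    ∑ (removeLeaf G) (matchCount F) + ∑ (replaceOne growT F) (λ H → matchCount H G)
      ≡⟨ cong (∑ (removeLeaf G) (matchCount F) +_) (matchCount-grow-prune F G) ⟩
    ∑ (removeLeaf G) (matchCount F) + ∑ (replaceOne pruneT G) (matchCount F)
      ≡⟨ ∑-pruneL G (matchCount F) ⟨
    ∑ (pruneL G) (matchCount F)
      ≡⟨ ∑-map node (pruneL G) (isoCount (node F)) ⟨
    ∑ (map node (pruneL G)) (isoCount (node F)) ∎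
    where open ≡-Reasoning

  matchCount-grow-prune : ∀ F G →
    ∑ (replaceOne growT F) (λ H → matchCount H G) ≡ ∑ (replaceOne pruneT G) (matchCount F)
  matchCount-grow-prune [] G = sym (∑-replaceOne-matchCount-[] G)
  matchCount-grow-prune (x ∷ F) G = begin
    ∑ (replaceOne growT (x ∷ F)) (λ H → matchCount H G)
      ≡⟨ ∑-replaceOne-∷ growT x F (λ H → matchCount H G) ⟩
    ∑ (growT x) (λ y → ∑ (picks G) (uncurry λ g G' → isoCount y g * matchCount F G'))
      + ∑ (replaceOne growT F) (λ H → ∑ (picks G) (uncurry λ g G' → isoCount x g * matchCount H G'))
      ≡⟨ cong₂ _+_ (∑-swap (growT x) (picks G) _) (∑-swap (replaceOne growT F) (picks G) _) ⟩
    ∑ (picks G) (λ p → ∑ (growT x) (λ y → isoCount y (proj₁ p) * matchCount F (proj₂ p)))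
      + ∑ (picks G) (λ p → ∑ (replaceOne growT F) (λ H → isoCount x (proj₁ p) * matchCount H (proj₂ p)))
      ≡⟨ cong₂ _+_ (∑-cong (picks G) (uncurry grown-root)) (∑-cong (picks G) (uncurry grown-rest)) ⟩
    ∑ (picks G) (uncurry λ g G' → ∑ (pruneT g) (λ z → isoCount x z * matchCount F G'))
      + ∑ (picks G) (uncurry λ g G' → ∑ (replaceOne pruneT G') (λ H → isoCount x g * matchCount F H))
      ≡⟨ ∑-+ (picks G) _ _ ⟨
    ∑ (picks G) (uncurry λ g G' → ∑ (pruneT g) (λ z → isoCount x z * matchCount F G')
                                 + ∑ (replaceOne pruneT G') (λ H → isoCount x g * matchCount F H))
      ≡⟨ ∑-replaceOne-picks pruneT G (λ a s → isoCount x a * matchCount F s) ⟨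
    ∑ (replaceOne pruneT G) (matchCount (x ∷ F)) ∎
    where
    open ≡-Reasoning
    grown-root : ∀ g G' → ∑ (growT x) (λ y → isoCount y g * matchCount F G')
                        ≡ ∑ (pruneT g) (λ z → isoCount x z * matchCount F G')
    grown-root g G' = begin
      ∑ (growT x) (λ y → isoCount y g * matchCount F G') ≡⟨ ∑-*ʳ (matchCount F G') (growT x) (λ y → isoCount y g) ⟩
      ∑ (growT x) (λ y → isoCount y g) * matchCount F G' ≡⟨ cong (_* matchCount F G') (isoCount-grow-prune x g) ⟩
      ∑ (pruneT g) (isoCount x) * matchCount F G'        ≡⟨ ∑-*ʳ (matchCount F G') (pruneT g) (isoCount x) ⟨
      ∑ (pruneT g) (λ z → isoCount x z * matchCount F G') ∎
    grown-rest : ∀ g G' → ∑ (replaceOne growT F) (λ H → isoCount x g * matchCount H G')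
                        ≡ ∑ (replaceOne pruneT G') (λ H → isoCount x g * matchCount F H)
    grown-rest g G' = begin
      ∑ (replaceOne growT F) (λ H → isoCount x g * matchCount H G')  ≡⟨ ∑-*ˡ (isoCount x g) (replaceOne growT F) _ ⟩
      isoCount x g * ∑ (replaceOne growT F) (λ H → matchCount H G')  ≡⟨ cong (isoCount x g *_) (matchCount-grow-prune F G') ⟩
      isoCount x g * ∑ (replaceOne pruneT G') (matchCount F)         ≡⟨ ∑-*ˡ (isoCount x g) (replaceOne pruneT G') _ ⟨
      ∑ (replaceOne pruneT G') (λ H → isoCount x g * matchCount F H) ∎

isoCount-resp-≅ˡ : ∀ {t t'} z → t ≅ t' → isoCount t z ≡ isoCount t' z
isoCount-resp-≅ˡ {t} {t'} z e = begin
  isoCount t z               ≡⟨ isoCount≡χ*sgOrder t z ⟩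
  χ (t ≅? z) * sgOrder t     ≡⟨ cong₂ _*_ (χ-cong (t ≅? z) (t' ≅? z) (trans (sym e)) (trans e)) (sgOrder-resp-≅ e) ⟩
  χ (t' ≅? z) * sgOrder t'   ≡⟨ isoCount≡χ*sgOrder t' z ⟨
  isoCount t' z              ∎
  where open ≡-Reasoning

isoCount-resp-≅ʳ : ∀ y {u u'} → u ≅ u' → isoCount y u ≡ isoCount y u'
isoCount-resp-≅ʳ y {u} {u'} e = begin
  isoCount y u               ≡⟨ isoCount≡χ*sgOrder y u ⟩
  χ (y ≅? u) * sgOrder y     ≡⟨ cong (_* sgOrder y) (χ-cong (y ≅? u) (y ≅? u') (λ y≅u → trans y≅u e) (λ y≅u' → trans y≅u' (sym e))) ⟩
  χ (y ≅? u') * sgOrder y    ≡⟨ isoCount≡χ*sgOrder y u' ⟨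
  isoCount y u'              ∎
  where open ≡-Reasoning

coeff*sgOrder≡∑isoCount : ∀ u xs → coeff u xs * sgOrder u ≡ ∑ xs (λ x → isoCount x u)
coeff*sgOrder≡∑isoCount u xs = begin
  coeff u xs * sgOrder u                  ≡⟨ cong (_* sgOrder u) (coeff≡∑ u xs) ⟩
  ∑ xs (λ x → χ (x ≅? u)) * sgOrder u     ≡⟨ ∑-*ʳ (sgOrder u) xs _ ⟨
  ∑ xs (λ x → χ (x ≅? u) * sgOrder u)     ≡⟨ ∑-cong xs term ⟩
  ∑ xs (λ x → isoCount x u)               ∎
  where
  open ≡-Reasoning
  term : ∀ x → χ (x ≅? u) * sgOrder u ≡ isoCount x u
  term x = trans (χ-*-congʳ (x ≅? u) (λ x≅u → sgOrder-resp-≅ (sym x≅u))) (sym (isoCount≡χ*sgOrder x u))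

sgOrder*coeff≡∑isoCount : ∀ t ys → sgOrder t * coeff t ys ≡ ∑ ys (isoCount t)
sgOrder*coeff≡∑isoCount t ys = begin
  sgOrder t * coeff t ys                  ≡⟨ cong (sgOrder t *_) (coeff≡∑ t ys) ⟩
  sgOrder t * ∑ ys (λ y → χ (y ≅? t))     ≡⟨ ∑-*ˡ (sgOrder t) ys _ ⟨
  ∑ ys (λ y → sgOrder t * χ (y ≅? t))     ≡⟨ ∑-cong ys term ⟩
  ∑ ys (isoCount t)                       ∎
  where
  open ≡-Reasoning
  term : ∀ y → sgOrder t * χ (y ≅? t) ≡ isoCount t y
  term y = begin
    sgOrder t * χ (y ≅? t)  ≡⟨ *-comm (sgOrder t) _ ⟩
    χ (y ≅? t) * sgOrder t  ≡⟨ cong (_* sgOrder t) (χ-cong (y ≅? t) (t ≅? y) sym sym) ⟩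
    χ (t ≅? y) * sgOrder t  ≡⟨ isoCount≡χ*sgOrder t y ⟨
    isoCount t y            ∎

coeff-growT*sgOrder≡sgOrder*coeff-pruneT : ∀ t u → coeff u (growT t) * sgOrder u ≡ sgOrder t * coeff t (pruneT u)
coeff-growT*sgOrder≡sgOrder*coeff-pruneT t u = begin
  coeff u (growT t) * sgOrder u          ≡⟨ coeff*sgOrder≡∑isoCount u (growT t) ⟩
  ∑ (growT t) (λ y → isoCount y u)       ≡⟨ isoCount-grow-prune t u ⟩
  ∑ (pruneT u) (isoCount t)              ≡⟨ sgOrder*coeff≡∑isoCount t (pruneT u) ⟨
  sgOrder t * coeff t (pruneT u)         ∎
  where open ≡-Reasoning

growT-resp-≅ : ∀ {t t'} u → t ≅ t' → coeff u (growT t) ≡ coeff u (growT t')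
growT-resp-≅ {t} {t'} u e = *-cancelʳ-≡ _ _ (sgOrder u) {{sgOrder-nonZero u}} (begin
  coeff u (growT t) * sgOrder u     ≡⟨ coeff*sgOrder≡∑isoCount u (growT t) ⟩
  ∑ (growT t) (λ y → isoCount y u)  ≡⟨ isoCount-grow-prune t u ⟩
  ∑ (pruneT u) (isoCount t)         ≡⟨ ∑-cong (pruneT u) (λ z → isoCount-resp-≅ˡ z e) ⟩
  ∑ (pruneT u) (isoCount t')        ≡⟨ isoCount-grow-prune t' u ⟨
  ∑ (growT t') (λ y → isoCount y u) ≡⟨ coeff*sgOrder≡∑isoCount u (growT t') ⟨
  coeff u (growT t') * sgOrder u    ∎)
  where open ≡-Reasoning

pruneT-resp-≅ : ∀ {u u'} t → u ≅ u' → coeff t (pruneT u) ≡ coeff t (pruneT u')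
pruneT-resp-≅ {u} {u'} t e = *-cancelˡ-≡ _ _ (sgOrder t) {{sgOrder-nonZero t}} (begin
  sgOrder t * coeff t (pruneT u)    ≡⟨ sgOrder*coeff≡∑isoCount t (pruneT u) ⟩
  ∑ (pruneT u) (isoCount t)         ≡⟨ isoCount-grow-prune t u ⟨
  ∑ (growT t) (λ y → isoCount y u)  ≡⟨ ∑-cong (growT t) (λ y → isoCount-resp-≅ʳ y e) ⟩
  ∑ (growT t) (λ y → isoCount y u') ≡⟨ isoCount-grow-prune t u' ⟩
  ∑ (pruneT u') (isoCount t)        ≡⟨ sgOrder*coeff≡∑isoCount t (pruneT u') ⟨
  sgOrder t * coeff t (pruneT u')   ∎)
  where open ≡-Reasoning

-- Sizes and the enumeration of trees

sizeL≡sum : ∀ ts → sizeL ts ≡ sum (map size ts)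
sizeL≡sum [] = refl
sizeL≡sum (t ∷ ts) = cong (size t +_) (sizeL≡sum ts)

sizeL-↭ : ∀ {ts us} → ts ↭ us → sizeL ts ≡ sizeL us
sizeL-↭ {ts} {us} p rewrite sizeL≡sum ts | sizeL≡sum us = ∑-↭ size p

mutual
  size-canonT : ∀ t → size (canonT t) ≡ size t
  size-canonT (node F) = cong suc (trans (sizeL-↭ (sortT-↭ (canonL F))) (sizeL-canonL F))

  sizeL-canonL : ∀ F → sizeL (canonL F) ≡ sizeL F
  sizeL-canonL [] = refl
  sizeL-canonL (x ∷ F) = cong₂ _+_ (size-canonT x) (sizeL-canonL F)

size-resp-≅ : ∀ {t u} → t ≅ u → size t ≡ size u
size-resp-≅ {t} {u} e = trans (sym (size-canonT t)) (trans (cong size e) (size-canonT u))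

size≢0 : ∀ t → size t ≢ 0
size≢0 (node _) ()

mutual
  growT-size : ∀ t → All (λ y → size y ≡ suc (size t)) (growT t)
  growT-size (node F) = refl ∷ Allₚ.map⁺ (All.map (cong suc) (growL-size F))

  growL-size : ∀ F → All (λ H → sizeL H ≡ suc (sizeL F)) (growL F)
  growL-size [] = []
  growL-size (x ∷ F) = Allₚ.++⁺
    (Allₚ.map⁺ (All.map (cong (_+ sizeL F)) (growT-size x)))
    (Allₚ.map⁺ (All.map (λ e → trans (cong (size x +_) e) (+-suc (size x) (sizeL F))) (growL-size F)))

leafHere-size : ∀ g gs → All (λ H → suc (sizeL H) ≡ sizeL (g ∷ gs)) (leafHere g gs)
leafHere-size (node []) gs = refl ∷ []
leafHere-size (node (_ ∷ _)) gs = []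

mutual
  pruneT-size : ∀ t → All (λ y → suc (size y) ≡ size t) (pruneT t)
  pruneT-size (node F) = Allₚ.map⁺ (All.map (cong suc) (pruneL-size F))

  pruneL-size : ∀ F → All (λ H → suc (sizeL H) ≡ sizeL F) (pruneL F)
  pruneL-size [] = []
  pruneL-size (x ∷ F) = Allₚ.++⁺ (leafHere-size x F) (Allₚ.++⁺
    (Allₚ.map⁺ (All.map (cong (_+ sizeL F)) (pruneT-size x)))
    (Allₚ.map⁺ (All.map (λ e → trans (sym (+-suc (size x) _)) (cong (size x +_) e)) (pruneL-size F))))

mutual
  treesF-size : ∀ f n → All (λ t → size t ≡ n) (treesF f n)
  treesF-size zero n = []
  treesF-size (suc f) zero = []
  treesF-size (suc f) (suc n) = Allₚ.map⁺ (All.map (cong suc) (forestsF-size f n))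

  forestsF-size : ∀ f n → All (λ F → sizeL F ≡ n) (forestsF f n)
  forestsF-size f zero = refl ∷ []
  forestsF-size zero (suc n) = []
  forestsF-size (suc f) (suc n) = splits-size f (suc n) (suc n) ≤-refl

  splits-size : ∀ f m i → i ≤ m → All (λ F → sizeL F ≡ m) (splits f m i)
  splits-size f m zero _ = []
  splits-size f m (suc i) i<m = Allₚ.++⁺
    (Allₚ.concat⁺ (Allₚ.map⁺ (All.map (λ st → Allₚ.map⁺ (All.map (λ sF → trans (cong₂ _+_ st sF) (m+[n∸m]≡n i<m))
                                                                  (forestsF-size f (m ∸ suc i))))
                                      (treesF-size f (suc i)))))
    (splits-size f m i (≤-trans (n≤1+n i) i<m))

occurrences : {A : Set} → ((x y : A) → Dec (x ≡ y)) → A → List A → ℕ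
occurrences _≟_ x xs = ∑ xs (λ y → χ (y ≟ x))

occurrences-absent : {A : Set} {P : A → Set} (_≟_ : (x y : A) → Dec (x ≡ y)) {x : A} {xs : List A} →
  All P xs → ¬ P x → occurrences _≟_ x xs ≡ 0
occurrences-absent _≟_ [] ¬px = refl
occurrences-absent _≟_ {x} (_∷_ {y} py pys) ¬px with y ≟ x
... | yes refl = ⊥-elim (¬px py)
... | no _ = occurrences-absent _≟_ pys ¬px

occurrences-map-node : ∀ F L → occurrences _≟T_ (node F) (map node L) ≡ occurrences _≟L_ F L
occurrences-map-node F L =
  trans (∑-map node L _) (∑-cong L (λ H → χ-cong (node H ≟T node F) (H ≟L F) node-inj (cong node)))

occurrences-map-∷ : ∀ t' Rs t rest →
  occurrences _≟L_ (t ∷ rest) (map (t' ∷_) Rs) ≡ χ (t' ≟T t) * occurrences _≟L_ rest Rs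
occurrences-map-∷ t' Rs t rest =
  trans (∑-map (t' ∷_) Rs _) (trans (∑-cong Rs χ-∷) (∑-*ˡ (χ (t' ≟T t)) Rs (λ R → χ (R ≟L rest))))
  where
  χ-∷ : ∀ R → χ ((t' ∷ R) ≟L (t ∷ rest)) ≡ χ (t' ≟T t) * χ (R ≟L rest)
  χ-∷ R with t' ≟T t | R ≟L rest
  ... | yes _ | yes _ = refl
  ... | yes _ | no _ = refl
  ... | no _ | _ = refl

χ-≡-suc+χ-≤ : ∀ a i → χ (a ≟ suc i) + χ (a ≤? i) ≡ χ (a ≤? suc i)
χ-≡-suc+χ-≤ a i with a ≟ suc i
... | yes refl = trans (cong suc (χ-no (suc i ≤? i) (<-irrefl refl))) (sym (χ-yes (suc i ≤? suc i) ≤-refl))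
... | no a≢suc-i = χ-cong (a ≤? i) (a ≤? suc i) (λ h → ≤-trans h (n≤1+n i)) (λ h → ≤-pred (≤∧≢⇒< h a≢suc-i))

-- Each level of a tree costs two units of fuel (treesF → forestsF → treesF), hence the bounds 2n ≤ fuel.
mutual
  treesF-occurrences : ∀ f n c → size c ≡ n → n + n ≤ suc f → occurrences _≟T_ c (treesF f n) ≡ 1
  treesF-occurrences f zero c e _ = ⊥-elim (size≢0 c e)
  treesF-occurrences zero (suc zero) c e (s≤s ())
  treesF-occurrences (suc f) (suc n) (node F) e fuel =
    trans (occurrences-map-node F (forestsF f n)) (forestsF-occurrences f n F (suc-injective e) (half-fuel n f fuel))
    where
    half-fuel : ∀ n f → suc n + suc n ≤ suc (suc f) → n + n ≤ f
    half-fuel n f le rewrite +-suc n n = ≤-pred (≤-pred le)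

  forestsF-occurrences : ∀ f n F → sizeL F ≡ n → n + n ≤ f → occurrences _≟L_ F (forestsF f n) ≡ 1
  forestsF-occurrences f zero [] e _ = refl
  forestsF-occurrences f zero (t ∷ _) e _ = ⊥-elim (size≢0 t (m+n≡0⇒m≡0 (size t) e))
  forestsF-occurrences (suc f) (suc n) (t ∷ rest) e fuel =
    trans (splits-occurrences f (suc n) (suc n) t rest e fuel (m≤n⇒m≤1+n fuel))
          (χ-yes (size t ≤? suc n) (subst (size t ≤_) e (m≤m+n (size t) (sizeL rest))))

  splits-occurrences : ∀ f m i t rest → sizeL (t ∷ rest) ≡ m → i + i ≤ suc f → m + m ≤ suc (suc f) →
    occurrences _≟L_ (t ∷ rest) (splits f m i) ≡ χ (size t ≤? i)
  splits-occurrences f m zero t rest e _ _ = sym (χ-no (size t ≤? 0) (λ h → size≢0 t (n≤0⇒n≡0 h)))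
  splits-occurrences f m (suc i) t rest e fuelᵢ fuelₘ = begin
    occurrences _≟L_ (t ∷ rest) (concatMap (λ t' → map (t' ∷_) (forestsF f (m ∸ suc i))) (treesF f (suc i)) ++ splits f m i)
      ≡⟨ ∑-++ (concatMap (λ t' → map (t' ∷_) (forestsF f (m ∸ suc i))) (treesF f (suc i))) _ _ ⟩
    occurrences _≟L_ (t ∷ rest) (concatMap (λ t' → map (t' ∷_) (forestsF f (m ∸ suc i))) (treesF f (suc i)))
      + occurrences _≟L_ (t ∷ rest) (splits f m i)
      ≡⟨ cong₂ _+_ (splits-head-occurrences f m i t rest e fuelᵢ fuelₘ)
                   (splits-occurrences f m i t rest e (≤-trans (+-mono-≤ (n≤1+n i) (n≤1+n i)) fuelᵢ) fuelₘ) ⟩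
    χ (size t ≟ suc i) + χ (size t ≤? i)
      ≡⟨ χ-≡-suc+χ-≤ (size t) i ⟩
    χ (size t ≤? suc i) ∎
    where open ≡-Reasoning

  splits-head-occurrences : ∀ f m i t rest → sizeL (t ∷ rest) ≡ m → suc i + suc i ≤ suc f → m + m ≤ suc (suc f) →
    occurrences _≟L_ (t ∷ rest) (concatMap (λ t' → map (t' ∷_) (forestsF f (m ∸ suc i))) (treesF f (suc i)))
    ≡ χ (size t ≟ suc i)
  splits-head-occurrences f m i t rest e fuelᵢ fuelₘ = begin
    occurrences _≟L_ (t ∷ rest) (concatMap (λ t' → map (t' ∷_) (forestsF f (m ∸ suc i))) (treesF f (suc i)))
      ≡⟨ ∑-concatMap _ (treesF f (suc i)) _ ⟩
    ∑ (treesF f (suc i)) (λ t' → occurrences _≟L_ (t ∷ rest) (map (t' ∷_) (forestsF f (m ∸ suc i))))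
      ≡⟨ ∑-cong (treesF f (suc i)) (λ t' → occurrences-map-∷ t' (forestsF f (m ∸ suc i)) t rest) ⟩
    ∑ (treesF f (suc i)) (λ t' → χ (t' ≟T t) * occurrences _≟L_ rest (forestsF f (m ∸ suc i)))
      ≡⟨ ∑-*ʳ _ (treesF f (suc i)) _ ⟩
    occurrences _≟T_ t (treesF f (suc i)) * occurrences _≟L_ rest (forestsF f (m ∸ suc i))
      ≡⟨ by-size (size t ≟ suc i) ⟩
    χ (size t ≟ suc i) ∎
    where
    open ≡-Reasoning
    by-size : (d : Dec (size t ≡ suc i)) →
      occurrences _≟T_ t (treesF f (suc i)) * occurrences _≟L_ rest (forestsF f (m ∸ suc i)) ≡ χ d
    by-size (no ¬st) = cong (_* occurrences _≟L_ rest (forestsF f (m ∸ suc i)))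
                            (occurrences-absent _≟T_ (treesF-size f (suc i)) ¬st)
    by-size (yes st) = cong₂ _*_ (treesF-occurrences f (suc i) t st fuelᵢ)
                                 (forestsF-occurrences f (m ∸ suc i) rest (sym m∸suc-i≡) fuel-rest)
      where
      m≡ : m ≡ suc i + sizeL rest
      m≡ = trans (sym e) (cong (_+ sizeL rest) st)
      m∸suc-i≡ : m ∸ suc i ≡ sizeL rest
      m∸suc-i≡ = trans (cong (_∸ suc i) m≡) (m+n∸m≡n (suc i) (sizeL rest))
      fuel-rest : (m ∸ suc i) + (m ∸ suc i) ≤ f
      fuel-rest rewrite m∸suc-i≡ | m≡ | +-suc (i + sizeL rest) (i + sizeL rest) =
        ≤-trans (+-mono-≤ (m≤n+m (sizeL rest) i) (m≤n+m (sizeL rest) i)) (≤-pred (≤-pred fuelₘ))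

treesOfSize-size : ∀ k → All (λ w → size w ≡ k) (treesOfSize k)
treesOfSize-size k = Allₚ.filter⁺ isCanon (treesF-size (suc (suc (k + k))) k)

coeff-treesOfSize : ∀ x k → size x ≡ k → coeff x (treesOfSize k) ≡ 1
coeff-treesOfSize x k e = begin
  coeff x (filter isCanon T)                        ≡⟨ coeff≡∑ x (filter isCanon T) ⟩
  ∑ (filter isCanon T) (λ w → χ (w ≅? x))           ≡⟨ ∑-filter isCanon T _ ⟩
  ∑ T (λ w → χ (isCanon w) * χ (w ≅? x))            ≡⟨ ∑-cong T canonical-match ⟩
  occurrences _≟T_ (canonT x) T                     ≡⟨ treesF-occurrences _ k (canonT x) (trans (size-canonT x) e) fuel ⟩
  1                                                 ∎
  where
  open ≡-Reasoning
  T = treesF (suc (suc (k + k))) k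
  fuel : k + k ≤ suc (suc (suc (k + k)))
  fuel = m≤n+m (k + k) 3
  canonical-match : ∀ w → χ (isCanon w) * χ (w ≅? x) ≡ χ (w ≟T canonT x)
  canonical-match w with isCanon w
  ... | no ¬canon = sym (χ-no (w ≟T canonT x) (λ w≡ → ¬canon (trans (cong canonT w≡) (trans (canonT-≅ x) (sym w≡)))))
  ... | yes canon = trans (+-identityʳ _) (χ-cong (w ≅? x) (w ≟T canonT x) (trans (sym canon)) (trans canon))

-- Iterated growth and pruning

∑-by-classes : (W : List Tree) (h : Tree → ℕ) → (∀ {x y} → x ≅ y → h x ≡ h y) → (xs : List Tree) →
  All (λ x → coeff x W ≡ 1) xs → ∑ xs h ≡ ∑ W (λ w → coeff w xs * h w)
∑-by-classes W h h-resp [] [] = sym (∑-zero W)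
∑-by-classes W h h-resp (x ∷ xs) (once ∷ onces) = begin
  h x + ∑ xs h
    ≡⟨ cong₂ _+_ hx (∑-by-classes W h h-resp xs onces) ⟩
  ∑ W (λ w → χ (w ≅? x) * h w) + ∑ W (λ w → coeff w xs * h w)
    ≡⟨ ∑-+ W _ _ ⟨
  ∑ W (λ w → χ (w ≅? x) * h w + coeff w xs * h w)
    ≡⟨ ∑-cong W merge ⟩
  ∑ W (λ w → coeff w (x ∷ xs) * h w) ∎
  where
  open ≡-Reasoning
  merge : ∀ w → χ (w ≅? x) * h w + coeff w xs * h w ≡ coeff w (x ∷ xs) * h w
  merge w = begin
    χ (w ≅? x) * h w + coeff w xs * h w ≡⟨ cong (λ c → c * h w + coeff w xs * h w) (χ-cong (w ≅? x) (x ≅? w) sym sym) ⟩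
    χ (x ≅? w) * h w + coeff w xs * h w ≡⟨ *-distribʳ-+ (h w) (χ (x ≅? w)) (coeff w xs) ⟨
    (χ (x ≅? w) + coeff w xs) * h w     ≡⟨ cong (_* h w) (coeff-∷ w x xs) ⟨
    coeff w (x ∷ xs) * h w              ∎
  hx : h x ≡ ∑ W (λ w → χ (w ≅? x) * h w)
  hx = sym (begin
    ∑ W (λ w → χ (w ≅? x) * h w) ≡⟨ ∑-cong W (λ w → χ-*-congʳ (w ≅? x) (h-resp)) ⟩
    ∑ W (λ w → χ (w ≅? x) * h x) ≡⟨ ∑-*ʳ (h x) W _ ⟩
    ∑ W (λ w → χ (w ≅? x)) * h x ≡⟨ cong (_* h x) (trans (sym (coeff≡∑ x W)) once) ⟩
    1 * h x                      ≡⟨ *-identityˡ (h x) ⟩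
    h x                          ∎)

iter-+ : {A : Set} (b a : ℕ) (f : A → A) (x : A) → iter (b + a) f x ≡ iter b f (iter a f x)
iter-+ zero a f x = refl
iter-+ (suc b) a f x = cong f (iter-+ b a f x)

iter-suc : ∀ b n → iter b suc n ≡ b + n
iter-suc zero n = refl
iter-suc (suc b) n = cong suc (iter-suc b n)

iter-pred : ∀ b n → iter b pred n ≡ n ∸ b
iter-pred zero n = refl
iter-pred (suc b) n = trans (cong pred (iter-pred b n)) (pred[m∸n]≡m∸[1+n] n b)

module Iterate (g : Tree → List Tree) where

  iter-[] : ∀ b → iter b (concatMap g) [] ≡ []
  iter-[] zero = refl
  iter-[] (suc b) = cong (concatMap g) (iter-[] b)

  iter-++ : ∀ b xs ys → iter b (concatMap g) (xs ++ ys) ≡ iter b (concatMap g) xs ++ iter b (concatMap g) ys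
  iter-++ zero xs ys = refl
  iter-++ (suc b) xs ys =
    trans (cong (concatMap g) (iter-++ b xs ys)) (concatMap-++ g (iter b (concatMap g) xs) (iter b (concatMap g) ys))

  coeff-iter : ∀ b u xs → coeff u (iter b (concatMap g) xs) ≡ ∑ xs (λ x → coeff u (iter b (concatMap g) [ x ]))
  coeff-iter b u [] = cong (coeff u) (iter-[] b)
  coeff-iter b u (x ∷ xs) = begin
    coeff u (iter b (concatMap g) ([ x ] ++ xs))
      ≡⟨ cong (coeff u) (iter-++ b [ x ] xs) ⟩
    coeff u (iter b (concatMap g) [ x ] ++ iter b (concatMap g) xs)
      ≡⟨ coeff-++ u (iter b (concatMap g) [ x ]) _ ⟩
    coeff u (iter b (concatMap g) [ x ]) + coeff u (iter b (concatMap g) xs)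
      ≡⟨ cong (coeff u (iter b (concatMap g) [ x ]) +_) (coeff-iter b u xs) ⟩
    coeff u (iter b (concatMap g) [ x ]) + ∑ xs (λ x → coeff u (iter b (concatMap g) [ x ])) ∎
    where open ≡-Reasoning

  module _ (σ : ℕ → ℕ) (g-size : ∀ t → All (λ y → size y ≡ σ (size t)) (g t))
           (g-resp-≅ : ∀ {t t'} u → t ≅ t' → coeff u (g t) ≡ coeff u (g t')) where

    iter-size : ∀ b {n xs} → All (λ x → size x ≡ n) xs → All (λ z → size z ≡ iter b σ n) (iter b (concatMap g) xs)
    iter-size zero sizes = sizes
    iter-size (suc b) sizes =
      Allₚ.concat⁺ (Allₚ.map⁺ (All.map (λ {x} e → All.map (λ e' → trans e' (cong σ e)) (g-size x)) (iter-size b sizes)))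

    iter-resp-≅ : ∀ b {x y} → x ≅ y → ∀ u → coeff u (iter b (concatMap g) [ x ]) ≡ coeff u (iter b (concatMap g) [ y ])
    iter-resp-≅ zero {x} {y} x≅y u =
      trans (coeff-singleton u x) (trans (χ-cong (x ≅? u) (y ≅? u) (trans (sym x≅y)) (trans x≅y)) (sym (coeff-singleton u y)))
    iter-resp-≅ (suc b) {x} {y} x≅y u = begin
      coeff u (concatMap g L)               ≡⟨ coeff-concatMap u g L ⟩
      ∑ L h                                 ≡⟨ ∑-by-classes W h (g-resp-≅ u) L (complete (iter-size b (refl ∷ []))) ⟩
      ∑ W (λ w → coeff w L * h w)           ≡⟨ ∑-cong W (λ w → cong (_* h w) (iter-resp-≅ b x≅y w)) ⟩
      ∑ W (λ w → coeff w L' * h w)          ≡⟨ ∑-by-classes W h (g-resp-≅ u) L' (complete (iter-size b (y≡x ∷ []))) ⟨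
      ∑ L' h                                ≡⟨ coeff-concatMap u g L' ⟨
      coeff u (concatMap g L')              ∎
      where
      open ≡-Reasoning
      L = iter b (concatMap g) [ x ]
      L' = iter b (concatMap g) [ y ]
      y≡x = sym (size-resp-≅ x≅y)
      h : Tree → ℕ
      h z = coeff u (g z)
      W = treesOfSize (iter b σ (size x))
      complete : ∀ {xs} → All (λ z → size z ≡ iter b σ (size x)) xs → All (λ z → coeff z W ≡ 1) xs
      complete = All.map (λ {z} e → coeff-treesOfSize z _ e)

    coeff-iter-+ : ∀ b a t u →
      coeff u (iter (b + a) (concatMap g) [ t ])
      ≡ ∑ (treesOfSize (iter a σ (size t))) (λ w → coeff w (iter a (concatMap g) [ t ]) * coeff u (iter b (concatMap g) [ w ]))
    coeff-iter-+ b a t u = begin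
      coeff u (iter (b + a) (concatMap g) [ t ])  ≡⟨ cong (coeff u) (iter-+ b a (concatMap g) [ t ]) ⟩
      coeff u (iter b (concatMap g) L)            ≡⟨ coeff-iter b u L ⟩
      ∑ L h                                       ≡⟨ ∑-by-classes W h (λ x≅y → iter-resp-≅ b x≅y u) L complete ⟩
      ∑ W (λ w → coeff w L * h w)                 ∎
      where
      open ≡-Reasoning
      L = iter a (concatMap g) [ t ]
      W = treesOfSize (iter a σ (size t))
      h : Tree → ℕ
      h w = coeff u (iter b (concatMap g) [ w ])
      complete : All (λ z → coeff z W ≡ 1) L
      complete = All.map (λ {z} e → coeff-treesOfSize z _ e) (iter-size a (refl ∷ []))

module Growth = Iterate growT
module Pruning = Iterate pruneT

pruneT-size-pred : ∀ t → All (λ y → size y ≡ pred (size t)) (pruneT t)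
pruneT-size-pred t = All.map (cong pred) (pruneT-size t)

nMult≡coeff-iter : ∀ {t t'} j → size t' ≡ j + size t → nMult t t' ≡ coeff t' (iter j 𝔑 [ t ])
nMult≡coeff-iter {t} {t'} j e = cong (λ n → coeff t' (iter n 𝔑 [ t ])) (trans (cong (_∸ size t) e) (m+n∸n≡m j (size t)))

mMult≡coeff-iter : ∀ {t t'} j → size t' ≡ j + size t → mMult t t' ≡ coeff t (iter j 𝔓 [ t' ])
mMult≡coeff-iter {t} {t'} j e = cong (λ n → coeff t (iter n 𝔓 [ t' ])) (trans (cong (_∸ size t) e) (m+n∸n≡m j (size t)))

nMult-composition : ∀ t t' k → size t ≤ k → k ≤ size t' →
  nMult t t' ≡ ∑ (treesOfSize k) (λ w → nMult t w * nMult w t')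
nMult-composition t t' k t≤k k≤t' = begin
  nMult t t'
    ≡⟨ nMult≡coeff-iter (b + a) (trans t'≡b+k (trans (cong (b +_) k≡a+t) (sym (+-assoc b a (size t))))) ⟩
  coeff t' (iter (b + a) 𝔑 [ t ])
    ≡⟨ Growth.coeff-iter-+ suc growT-size growT-resp-≅ b a t t' ⟩
  ∑ (treesOfSize (iter a suc (size t))) (λ w → coeff w (iter a 𝔑 [ t ]) * coeff t' (iter b 𝔑 [ w ]))
    ≡⟨ cong (λ n → ∑ (treesOfSize n) (λ w → coeff w (iter a 𝔑 [ t ]) * coeff t' (iter b 𝔑 [ w ])))
            (trans (iter-suc a (size t)) (sym k≡a+t)) ⟩
  ∑ (treesOfSize k) (λ w → coeff w (iter a 𝔑 [ t ]) * coeff t' (iter b 𝔑 [ w ]))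
    ≡⟨ ∑-cong-All (All.map (λ w≡k → sym (cong₂ _*_ (nMult≡coeff-iter a (trans w≡k k≡a+t))
                                                    (nMult≡coeff-iter b (trans t'≡b+k (cong (b +_) (sym w≡k))))))
                           (treesOfSize-size k)) ⟩
  ∑ (treesOfSize k) (λ w → nMult t w * nMult w t') ∎
  where
  open ≡-Reasoning
  a = k ∸ size t
  b = size t' ∸ k
  k≡a+t : k ≡ a + size t
  k≡a+t = sym (m∸n+n≡m t≤k)
  t'≡b+k : size t' ≡ b + k
  t'≡b+k = sym (m∸n+n≡m k≤t')

mMult-composition : ∀ t t' k → size t ≤ k → k ≤ size t' →
  mMult t t' ≡ ∑ (treesOfSize k) (λ w → mMult t w * mMult w t')
mMult-composition t t' k t≤k k≤t' = begin
  mMult t t'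
    ≡⟨ mMult≡coeff-iter (a + b) (trans t'≡b+k (trans (cong (b +_) k≡a+t)
                                  (trans (sym (+-assoc b a (size t))) (cong (_+ size t) (+-comm b a))))) ⟩
  coeff t (iter (a + b) 𝔓 [ t' ])
    ≡⟨ Pruning.coeff-iter-+ pred pruneT-size-pred pruneT-resp-≅ a b t' t ⟩
  ∑ (treesOfSize (iter b pred (size t'))) (λ w → coeff w (iter b 𝔓 [ t' ]) * coeff t (iter a 𝔓 [ w ]))
    ≡⟨ cong (λ n → ∑ (treesOfSize n) (λ w → coeff w (iter b 𝔓 [ t' ]) * coeff t (iter a 𝔓 [ w ])))
            (trans (iter-pred b (size t')) (trans (cong (_∸ b) t'≡b+k) (m+n∸m≡n b k))) ⟩
  ∑ (treesOfSize k) (λ w → coeff w (iter b 𝔓 [ t' ]) * coeff t (iter a 𝔓 [ w ]))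
    ≡⟨ ∑-cong-All (All.map (λ {w} w≡k → trans (*-comm (coeff w (iter b 𝔓 [ t' ])) (coeff t (iter a 𝔓 [ w ])))
                                               (sym (cong₂ _*_ (mMult≡coeff-iter a (trans w≡k k≡a+t))
                                                               (mMult≡coeff-iter b (trans t'≡b+k (cong (b +_) (sym w≡k)))))))
                           (treesOfSize-size k)) ⟩
  ∑ (treesOfSize k) (λ w → mMult t w * mMult w t') ∎
  where
  open ≡-Reasoning
  a = k ∸ size t
  b = size t' ∸ k
  k≡a+t : k ≡ a + size t
  k≡a+t = sym (m∸n+n≡m t≤k)
  t'≡b+k : size t' ≡ b + k
  t'≡b+k = sym (m∸n+n≡m k≤t')

nMult*sgOrder≡sgOrder*mMult-step : ∀ w t' → size t' ≡ suc (size w) → nMult w t' * sgOrder t' ≡ sgOrder w * mMult w t'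
nMult*sgOrder≡sgOrder*mMult-step w t' e = begin
  nMult w t' * sgOrder t'          ≡⟨ cong (_* sgOrder t') (trans (nMult≡coeff-iter 1 e) (coeff-++-[] t' (growT w))) ⟩
  coeff t' (growT w) * sgOrder t'  ≡⟨ coeff-growT*sgOrder≡sgOrder*coeff-pruneT w t' ⟩
  sgOrder w * coeff w (pruneT t')  ≡⟨ cong (sgOrder w *_) (trans (mMult≡coeff-iter 1 e) (coeff-++-[] w (pruneT t'))) ⟨
  sgOrder w * mMult w t'           ∎
  where open ≡-Reasoning

nMult*sgOrder≡sgOrder*mMult : ∀ j t t' → size t' ≡ j + size t → nMult t t' * sgOrder t' ≡ sgOrder t * mMult t t'
nMult*sgOrder≡sgOrder*mMult zero t t' e = begin
  nMult t t' * sgOrder t'     ≡⟨ cong (_* sgOrder t') (trans (nMult≡coeff-iter 0 e) (coeff-singleton t' t)) ⟩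
  χ (t ≅? t') * sgOrder t'    ≡⟨ χ-*-congʳ (t ≅? t') (λ t≅t' → sgOrder-resp-≅ (sym t≅t')) ⟩
  χ (t ≅? t') * sgOrder t     ≡⟨ *-comm (χ (t ≅? t')) (sgOrder t) ⟩
  sgOrder t * χ (t ≅? t')     ≡⟨ cong (sgOrder t *_) (χ-cong (t ≅? t') (t' ≅? t) sym sym) ⟩
  sgOrder t * χ (t' ≅? t)     ≡⟨ cong (sgOrder t *_) (trans (mMult≡coeff-iter 0 e) (coeff-singleton t t')) ⟨
  sgOrder t * mMult t t'      ∎
  where open ≡-Reasoning
nMult*sgOrder≡sgOrder*mMult (suc j) t t' e = begin
  nMult t t' * sgOrder t'                               ≡⟨ cong (_* sgOrder t') (nMult-composition t t' k t≤k k≤t') ⟩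
  ∑ W (λ w → nMult t w * nMult w t') * sgOrder t'       ≡⟨ ∑-*ʳ (sgOrder t') W _ ⟨
  ∑ W (λ w → nMult t w * nMult w t' * sgOrder t')       ≡⟨ ∑-cong-All (All.map through (treesOfSize-size k)) ⟩
  ∑ W (λ w → sgOrder t * (mMult t w * mMult w t'))      ≡⟨ ∑-*ˡ (sgOrder t) W _ ⟩
  sgOrder t * ∑ W (λ w → mMult t w * mMult w t')        ≡⟨ cong (sgOrder t *_) (mMult-composition t t' k t≤k k≤t') ⟨
  sgOrder t * mMult t t'                                ∎
  where
  open ≡-Reasoning
  k = j + size t
  W = treesOfSize k
  t≤k : size t ≤ k
  t≤k = m≤n+m (size t) j
  k≤t' : k ≤ size t'
  k≤t' = ≤-trans (n≤1+n k) (≤-reflexive (sym e))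
  through : ∀ {w} → size w ≡ k → nMult t w * nMult w t' * sgOrder t' ≡ sgOrder t * (mMult t w * mMult w t')
  through {w} w≡k = begin
    nMult t w * nMult w t' * sgOrder t'   ≡⟨ *-assoc (nMult t w) _ _ ⟩
    nMult t w * (nMult w t' * sgOrder t') ≡⟨ cong (nMult t w *_) (nMult*sgOrder≡sgOrder*mMult-step w t' t'≡1+w) ⟩
    nMult t w * (sgOrder w * mMult w t')  ≡⟨ *-assoc (nMult t w) _ _ ⟨
    nMult t w * sgOrder w * mMult w t'    ≡⟨ cong (_* mMult w t') (nMult*sgOrder≡sgOrder*mMult j t w w≡k) ⟩
    sgOrder t * mMult t w * mMult w t'    ≡⟨ *-assoc (sgOrder t) _ _ ⟩
    sgOrder t * (mMult t w * mMult w t')  ∎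
    where
    t'≡1+w : size t' ≡ suc (size w)
    t'≡1+w = trans e (cong suc (sym w≡k))

-- The embedding order

*≡*-≢0⇔≢0 : ∀ {a b c d} → NonZero c → NonZero d → a * c ≡ d * b → a ≢ 0 ⇔ b ≢ 0
*≡*-≢0⇔≢0 {a} {b} {c} {d} c≢0 d≢0 e = mk⇔
  (λ a≢0 b≡0 → a≢0 (m*n≡0⇒m≡0 a c {{c≢0}} (trans e (trans (cong (d *_) b≡0) (*-zeroʳ d)))))
  (λ b≢0 a≡0 → b≢0 (m*n≡0⇒m≡0 b d {{d≢0}} (trans (*-comm b d) (trans (sym e) (cong (_* c) a≡0)))))

Any-∩-All : {A : Set} {P Q : A → Set} {xs : List A} → All P xs → Any Q xs → Any (λ x → P x × Q x) xs
Any-∩-All (px ∷ _) (here qx) = here (px , qx)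
Any-∩-All (_ ∷ pxs) (there any) = there (Any-∩-All pxs any)

mutual
  ⪯-refl : ∀ t → t ⪯ t
  ⪯-refl (node ts) = emb ↭-refl (Sublist-⪯-refl ts)

  Sublist-⪯-refl : ∀ ts → Sublist _⪯_ ts ts
  Sublist-⪯-refl [] = []
  Sublist-⪯-refl (t ∷ ts) = ⪯-refl t ∷ Sublist-⪯-refl ts

leaf-⪯ : ∀ t → leaf ⪯ t
leaf-⪯ (node ts) = emb ↭-refl (minimum ts)

mutual
  size-mono-⪯ : ∀ {t u} → t ⪯ u → size t ≤ size u
  size-mono-⪯ (emb p s) = s≤s (≤-trans (sizeL-mono-Sublist s) (≤-reflexive (sym (sizeL-↭ p))))

  sizeL-mono-Sublist : ∀ {ts us} → Sublist _⪯_ ts us → sizeL ts ≤ sizeL us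
  sizeL-mono-Sublist [] = z≤n
  sizeL-mono-Sublist (y ∷ʳ s) = ≤-trans (sizeL-mono-Sublist s) (m≤n+m _ (size y))
  sizeL-mono-Sublist (r ∷ s) = +-mono-≤ (size-mono-⪯ r) (sizeL-mono-Sublist s)

Sublist-extract : ∀ {x xs ws} → Sublist _⪯_ (x ∷ xs) ws →
  ∃[ w ] ∃[ ws' ] (x ⪯ w × ws ↭ w ∷ ws' × Sublist _⪯_ xs ws')
Sublist-extract (y ∷ʳ s) with Sublist-extract s
... | w , ws' , r , p , s' = w , y ∷ ws' , r , ↭-trans (↭-prep y p) (↭-swap y w ↭-refl) , y ∷ʳ s'
Sublist-extract (_∷_ {y = y} {ys = ys} r s) = y , ys , r , ↭-refl , s

↭-Sublist : ∀ {us us' vs} → us ↭ us' → Sublist _⪯_ us vs → ∃[ vs' ] (vs ↭ vs' × Sublist _⪯_ us' vs')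
↭-Sublist ↭.refl s = _ , ↭-refl , s
↭-Sublist (↭.prep x p) s with Sublist-extract s
... | w , ws , r , q , s' with ↭-Sublist p s'
...   | vs' , q' , s'' = w ∷ vs' , ↭-trans q (↭-prep w q') , r ∷ s''
↭-Sublist (↭.swap x y p) s with Sublist-extract s
... | a , ws₁ , ra , q₁ , s₁ with Sublist-extract s₁
...   | b , ws₂ , rb , q₂ , s₂ with ↭-Sublist p s₂
...     | ws₃ , q₃ , s₃ =
  b ∷ a ∷ ws₃ , ↭-trans q₁ (↭-trans (↭-prep a (↭-trans q₂ (↭-prep b q₃))) (↭-swap a b ↭-refl)) , rb ∷ ra ∷ s₃
↭-Sublist (↭.trans p q) s with ↭-Sublist p s
... | vs₁ , q₁ , s₁ with ↭-Sublist q s₁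
...   | vs₂ , q₂ , s₂ = vs₂ , ↭-trans q₁ q₂ , s₂

mutual
  ⪯-trans : ∀ {a b c} → a ⪯ b → b ⪯ c → a ⪯ c
  ⪯-trans (emb p₁ s₁) (emb p₂ s₂) with ↭-Sublist p₁ s₂
  ... | vs , q , s = emb (↭-trans p₂ q) (Sublist-⪯-trans s₁ s)

  Sublist-⪯-trans : ∀ {as bs cs} → Sublist _⪯_ as bs → Sublist _⪯_ bs cs → Sublist _⪯_ as cs
  Sublist-⪯-trans s₁ (y ∷ʳ s₂) = y ∷ʳ Sublist-⪯-trans s₁ s₂
  Sublist-⪯-trans [] [] = []
  Sublist-⪯-trans (y ∷ʳ s₁) (r ∷ s₂) = _ ∷ʳ Sublist-⪯-trans s₁ s₂
  Sublist-⪯-trans (r₁ ∷ s₁) (r₂ ∷ s₂) = ⪯-trans r₁ r₂ ∷ Sublist-⪯-trans s₁ s₂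

node-⪯-↭ˡ : ∀ {F F' G} → F ↭ F' → node F ⪯ node G → node F' ⪯ node G
node-⪯-↭ˡ p (emb q s) with ↭-Sublist p s
... | vs , q' , s' = emb (↭-trans q q') s'

mutual
  ⪯-canonT : ∀ t → t ⪯ canonT t
  ⪯-canonT (node ts) = emb (sortT-↭ (canonL ts)) (Sublist-canonL ts)

  Sublist-canonL : ∀ ts → Sublist _⪯_ ts (canonL ts)
  Sublist-canonL [] = []
  Sublist-canonL (t ∷ ts) = ⪯-canonT t ∷ Sublist-canonL ts

mutual
  canonT-⪯ : ∀ t → canonT t ⪯ t
  canonT-⪯ (node ts) = node-⪯-↭ˡ (↭-sym (sortT-↭ (canonL ts))) (emb ↭-refl (canonL-Sublist ts))

  canonL-Sublist : ∀ ts → Sublist _⪯_ (canonL ts) ts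
  canonL-Sublist [] = []
  canonL-Sublist (t ∷ ts) = canonT-⪯ t ∷ canonL-Sublist ts

≅⇒⪯ : ∀ {t u} → t ≅ u → t ⪯ u
≅⇒⪯ {t} {u} e = ⪯-trans (⪯-canonT t) (subst (_⪯ u) (sym e) (canonT-⪯ u))

mutual
  growT-⪰ : ∀ t → All (t ⪯_) (growT t)
  growT-⪰ (node F) = emb ↭-refl (leaf ∷ʳ Sublist-⪯-refl F) ∷ Allₚ.map⁺ (All.map (emb ↭-refl) (growL-⊒ F))

  growL-⊒ : ∀ F → All (Sublist _⪯_ F) (growL F)
  growL-⊒ [] = []
  growL-⊒ (x ∷ F) = Allₚ.++⁺
    (Allₚ.map⁺ (All.map (_∷ Sublist-⪯-refl F) (growT-⪰ x)))
    (Allₚ.map⁺ (All.map (⪯-refl x ∷_) (growL-⊒ F)))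

iter-𝔑-⪰ : ∀ j t → All (t ⪯_) (iter j 𝔑 [ t ])
iter-𝔑-⪰ zero t = ⪯-refl t ∷ []
iter-𝔑-⪰ (suc j) t =
  Allₚ.concat⁺ (Allₚ.map⁺ (All.map (λ {x} t⪯x → All.map (⪯-trans t⪯x) (growT-⪰ x)) (iter-𝔑-⪰ j t)))

coeff≢0⇒∃ : ∀ {P : Tree → Set} u {L} → All P L → coeff u L ≢ 0 → ∃[ x ] (P x × x ≅ u)
coeff≢0⇒∃ u [] c≢0 = ⊥-elim (c≢0 refl)
coeff≢0⇒∃ u (_∷_ {x} px pxs) c≢0 with x ≅? u
... | yes x≅u = x , px , x≅u
... | no _ = coeff≢0⇒∃ u pxs c≢0

nMult≢0⇒⪯ : ∀ t t' → nMult t t' ≢ 0 → t ⪯ t'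
nMult≢0⇒⪯ t t' n≢0 with coeff≢0⇒∃ t' (iter-𝔑-⪰ (size t' ∸ size t) t) n≢0
... | x , t⪯x , x≅t' = ⪯-trans t⪯x (≅⇒⪯ x≅t')

+-≤-≡-split : ∀ {a b c d} → a ≤ b → c ≤ d → a + c ≡ b + d → a ≡ b × c ≡ d
+-≤-≡-split {a} {b} {c} {d} a≤b c≤d e with m≤n⇒m<n∨m≡n a≤b
... | inj₁ a<b = ⊥-elim (<-irrefl e (+-mono-<-≤ a<b c≤d))
... | inj₂ refl = refl , +-cancelˡ-≡ a c d e

mutual
  ⪯-size-≡⇒≅ : ∀ {t u} → t ⪯ u → size t ≡ size u → t ≅ u
  ⪯-size-≡⇒≅ {node ts} {node us} (emb {us' = us'} p s) e = ↭⇒node-≅ (subst (_↭ canonL us) (sym ts≡us') (canonL-↭ (↭-sym p)))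
    where
    ts≡us' : canonL ts ≡ canonL us'
    ts≡us' = Sublist-sizeL-≡⇒canonL s (trans (suc-injective e) (sizeL-↭ p))

  Sublist-sizeL-≡⇒canonL : ∀ {ts us} → Sublist _⪯_ ts us → sizeL ts ≡ sizeL us → canonL ts ≡ canonL us
  Sublist-sizeL-≡⇒canonL [] e = refl
  Sublist-sizeL-≡⇒canonL (y ∷ʳ s) e = ⊥-elim (<-irrefl e (≤-<-trans (sizeL-mono-Sublist s) (skipped y _)))
    where
    skipped : ∀ y n → n < size y + n
    skipped (node _) n = s≤s (m≤n+m n _)
  Sublist-sizeL-≡⇒canonL (r ∷ s) e with +-≤-≡-split (size-mono-⪯ r) (sizeL-mono-Sublist s) e
  ... | e₁ , e₂ = cong₂ _∷_ (⪯-size-≡⇒≅ r e₁) (Sublist-sizeL-≡⇒canonL s e₂)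

mutual
  growT-towards : ∀ {t u} → t ⪯ u → size t < size u → Any (_⪯ u) (growT t)
  growT-towards {node ts} {node us} (emb p s) lt with growL-towards s (subst (sizeL ts <_) (sizeL-↭ p) (≤-pred lt))
  ... | inj₁ any = there (Anyₚ.map⁺ (Any.map (emb p) any))
  ... | inj₂ (w , ws , q , s') = here (emb (↭-trans p q) (leaf-⪯ w ∷ s'))

  growL-towards : ∀ {ts vs} → Sublist _⪯_ ts vs → sizeL ts < sizeL vs →
    Any (λ H → Sublist _⪯_ H vs) (growL ts) ⊎ ∃[ w ] ∃[ ws ] (vs ↭ w ∷ ws × Sublist _⪯_ ts ws)
  growL-towards (v ∷ʳ s) lt = inj₂ (v , _ , ↭-refl , s)
  growL-towards {a ∷ as} {b ∷ bs} (r ∷ s) lt with m≤n⇒m<n∨m≡n (size-mono-⪯ r)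
  ... | inj₁ a<b = inj₁ (Anyₚ.++⁺ˡ (Anyₚ.map⁺ (Any.map (_∷ s) (growT-towards r a<b))))
  ... | inj₂ a≡b with growL-towards s (+-cancelˡ-< (size b) (sizeL as) (sizeL bs) (subst (_< size b + sizeL bs) (cong (_+ sizeL as) a≡b) lt))
  ...   | inj₁ any = inj₁ (Anyₚ.++⁺ʳ (map (_∷ as) (growT a)) (Anyₚ.map⁺ (Any.map (r ∷_) any)))
  ...   | inj₂ (w , ws , q , s') = inj₂ (w , b ∷ ws , ↭-trans (↭-prep b q) (↭-swap b w ↭-refl) , r ∷ s')

⪯⇒coeff-iter≢0 : ∀ j t t' → t ⪯ t' → size t' ≡ j + size t → coeff t' (iter j 𝔑 [ t ]) ≢ 0
⪯⇒coeff-iter≢0 zero t t' t⪯t' e =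
  subst (_≢ 0) (sym (trans (coeff-singleton t' t) (χ-yes (t ≅? t') (⪯-size-≡⇒≅ t⪯t' (sym e))))) (λ ())
⪯⇒coeff-iter≢0 (suc j) t t' t⪯t' e = subst (_≢ 0) (sym unfold-first-step) (∑-≢0 (growT t ++ []) _ (Anyₚ.++⁺ˡ reaches-t'))
  where
  unfold-first-step : coeff t' (iter (suc j) 𝔑 [ t ]) ≡ ∑ (growT t ++ []) (λ y → coeff t' (iter j 𝔑 [ y ]))
  unfold-first-step = trans (cong (λ n → coeff t' (iter n 𝔑 [ t ])) (+-comm 1 j))
                            (trans (cong (coeff t') (iter-+ j 1 𝔑 [ t ])) (Growth.coeff-iter j t' (growT t ++ [])))
  t<t' : size t < size t'
  t<t' = subst (size t <_) (sym e) (s≤s (m≤n+m (size t) j))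
  t'≡j+y : ∀ {y} → size y ≡ suc (size t) → size t' ≡ j + size y
  t'≡j+y y-size = trans e (trans (sym (+-suc j (size t))) (cong (j +_) (sym y-size)))
  reaches-t' : Any (λ y → coeff t' (iter j 𝔑 [ y ]) ≢ 0) (growT t)
  reaches-t' = Any.map (λ (y-size , y⪯t') → ⪯⇒coeff-iter≢0 j _ t' y⪯t' (t'≡j+y y-size))
                       (Any-∩-All (growT-size t) (growT-towards t⪯t' t<t'))

⪯⇒nMult≢0 : ∀ t t' → t ⪯ t' → nMult t t' ≢ 0
⪯⇒nMult≢0 t t' t⪯t' = subst (_≢ 0) (sym (nMult≡coeff-iter j t'≡j+t)) (⪯⇒coeff-iter≢0 j t t' t⪯t' t'≡j+t)
  where
  j = size t' ∸ size t
  t'≡j+t : size t' ≡ j + size t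
  t'≡j+t = sym (m∸n+n≡m (size-mono-⪯ t⪯t'))

proposition2p5 : (t t' : Tree) → size t ≤ size t' →
    (nMult t t' * sgOrder t' ≡ sgOrder t * mMult t t')
    × ((k : ℕ) → size t ≤ k → k ≤ size t' →
        (nMult t t' ≡ sum (map (λ t'' → nMult t t'' * nMult t'' t') (treesOfSize k)))
        × (mMult t t' ≡ sum (map (λ t'' → mMult t t'' * mMult t'' t') (treesOfSize k))))
    × ((nMult t t' ≢ 0 ⇔ t ⪯ t') × (mMult t t' ≢ 0 ⇔ t ⪯ t'))
proposition2p5 t t' t≤t' =
  n|SG|≡|SG|m ,
  (λ k t≤k k≤t' → nMult-composition t t' k t≤k k≤t' , mMult-composition t t' k t≤k k≤t') ,
  nMult≢0⇔⪯ ,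
  ⇔.trans (⇔.sym (*≡*-≢0⇔≢0 (sgOrder-nonZero t') (sgOrder-nonZero t) n|SG|≡|SG|m)) nMult≢0⇔⪯
  where
  n|SG|≡|SG|m : nMult t t' * sgOrder t' ≡ sgOrder t * mMult t t'
  n|SG|≡|SG|m = nMult*sgOrder≡sgOrder*mMult (size t' ∸ size t) t t' (sym (m∸n+n≡m t≤t'))
  nMult≢0⇔⪯ : nMult t t' ≢ 0 ⇔ t ⪯ t'
  nMult≢0⇔⪯ = mk⇔ (nMult≢0⇒⪯ t t') (⪯⇒nMult≢0 t t')
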